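{- For every positive integer $n$, \[S_{n,132}(231)=S_{n,132}(312)=S_{n,132}(213).\]
   Context: A permutation $p=p_1\cdots p_n$ contains a pattern $q=q_1\cdots q_k\in S_k$ if there are indices $i_1<\cdots<i_k$ such that $p_{i_t}<p_{i_u}$ if and only if $q_t<q_u$ for all $1\le t,u\le k$; each such subsequence is a copy (occurrence) of $q$ in $p$. The permutation $p$ avoids $q$ if it contains no copy of $q$. For patterns $r,q$, $S_{n,r}(q)$ denotes the total number of copies of $q$ in all $r$-avoiding permutations of length $n$ (summed over all such permutations). -}

module Defs where

open import Data.Nat using (ℕ; zero; suc; _<ᵇ_)
open import Data.Bool using (Bool; true; false; _∧_; if_then_else_)
open import Data.Bool.Properties using (_≟_)
open import Data.List using (List; []; _∷_; _++_; map; concatMap; filter; length)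
open import Data.Nat.ListAction using (sum)
open import Relation.Nullary.Decidable using (Dec)
open import Relation.Binary.PropositionalEquality using (_≡_)

_==_ : Bool → Bool → Bool
true  == true  = true
false == false = true
_     == _     = false

insertAll : ℕ → List ℕ → List (List ℕ)
insertAll x []       = (x ∷ []) ∷ []
insertAll x (y ∷ ys) = (x ∷ y ∷ ys) ∷ map (y ∷_) (insertAll x ys)

perms : ℕ → List (List ℕ)
perms zero    = [] ∷ []
perms (suc n) = concatMap (insertAll (suc n)) (perms n)

-- All subsequences (one entry per choice of index set i₁ < ⋯ < iₖ).
subseqs : List ℕ → List (List ℕ)
subseqs []       = [] ∷ []
subseqs (x ∷ xs) = map (x ∷_) (subseqs xs) ++ subseqs xs

-- x,a are the t-th entries and ys,bs the later entries of the two words: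
-- check x < y ⇔ a < b and y < x ⇔ b < a for all later positions u.
compat : ℕ → ℕ → List ℕ → List ℕ → Bool
compat x a []       []       = true
compat x a (y ∷ ys) (b ∷ bs) =
  ((x <ᵇ y) == (a <ᵇ b)) ∧ ((y <ᵇ x) == (b <ᵇ a)) ∧ compat x a ys bs
compat x a _        _        = false

-- orderIso s q : s and q have the same length k and
-- s_t < s_u iff q_t < q_u for all 1 ≤ t,u ≤ k.
orderIso : List ℕ → List ℕ → Bool
orderIso []       []       = true
orderIso (x ∷ xs) (a ∷ as) = compat x a xs as ∧ orderIso xs as
orderIso _        _        = false

copies : List ℕ → List ℕ → ℕ
copies p q = length (filter (λ s → orderIso s q ≟ true) (subseqs p))

avoidsᵇ : List ℕ → List ℕ → Bool
avoidsᵇ p r with copies p r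
... | zero  = true
... | suc _ = false

S : ℕ → List ℕ → List ℕ → ℕ
S n r q = sum (map (λ p → copies p q) (filter (λ p → avoidsᵇ p r ≟ true) (perms n)))

p132 p231 p312 p213 : List ℕ
p132 = 1 ∷ 3 ∷ 2 ∷ []
p231 = 2 ∷ 3 ∷ 1 ∷ []
p312 = 3 ∷ 1 ∷ 2 ∷ []
p213 = 2 ∷ 1 ∷ 3 ∷ []

module Submission where

-- Write T_q(n) = S_{n,132}(q). A 132-avoiding permutation of length n + 1 factors uniquely as
-- (L + j) (n + 1) R, where L and R are 132-avoiders of lengths i and j with i + j = n: every entry
-- left of the maximum exceeds every entry right of it. Sorting the copies of a pattern q of length 3
-- by how they meet this factorisation gives
--   T_q(n + 1) = Σ_{i + j = n} (T_q(i) C(j) + C(i) T_q(j)) + V_q(n),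
-- where C counts the avoiders, A and I are the total numbers of their non-inversions and inversions,
-- E(n) = n C(n), ⋆ is convolution, and V_213 = I ⋆ C, V_312 = (C + E) ⋆ A, V_231 = (A + E) ⋆ E.
-- The same factorisation gives recurrences of this shape for A and I, and from them the identities
-- C ⋆ A = E ⋆ E and I ⋆ C = E ⋆ A + C ⋆ A follow because both sides solve a common recurrence.
-- Hence V_213 = V_312 = V_231, and the three sequences, all starting at 0, solve one recurrence.

open import Defs
open import Data.Bool using (Bool; true; false; _∧_; not; if_then_else_)
open import Data.Bool.Properties using (_≟_; ∧-assoc; ∧-zeroʳ)
open import Data.Empty using (⊥-elim)
open import Data.List using (List; []; _∷_; _++_; map; concatMap; filter; length)
open import Data.List.Extrema.Nat using (max; xs≤max; max<v⁺; max≤v⁺)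
open import Data.List.Membership.Propositional using (_∈_; _∉_; find; lose)
open import Data.List.Membership.Propositional.Properties
  using (∈-++⁻; ∈-++⁺ˡ; ∈-++⁺ʳ; ∈-map⁻; ∈-map⁺; ∈-∃++; ∈-filter⁻; ∈-filter⁺; ∈-concatMap⁺; ∈-concatMap⁻)
open import Data.List.Membership.Propositional.Properties.WithK using (unique∧set⇒bag)
open import Data.List.Properties
  using (++-assoc; ++-identityʳ; ++-cancelˡ; ∷-injective; ∷-injectiveʳ; length-++; length-map; map-++; map-∘;
         map-cong; map-cong-local; map-id; map-injective; filter-++; filter-all; filter-none; filter-some)
open import Data.List.Relation.Binary.BagAndSetEquality using (∼bag⇒↭)
open import Data.List.Relation.Binary.Permutation.Propositional
  using (_↭_; ↭-sym; ↭-trans; ↭-refl; ↭-reflexive; prep; ↭⇒↭ₛ; module PermutationReasoning)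
open import Data.List.Relation.Binary.Permutation.Propositional.Properties
  using (∈-resp-↭; ↭-length; shift; drop-∷; ++-comm; ↭-empty-inv; ++⁺; filter-↭; map⁺)
import Data.List.Relation.Binary.Permutation.Setoid.Properties as Permutationₛ
open import Data.List.Relation.Unary.All as All using (All; []; _∷_)
import Data.List.Relation.Unary.All.Properties as All
open import Data.List.Relation.Unary.Any using (here; there)
open import Data.List.Relation.Unary.Unique.Propositional using (Unique; []; _∷_)
import Data.List.Relation.Unary.Unique.Propositional.Properties as Unique
open import Data.Nat using (ℕ; zero; suc; _+_; _*_; _∸_; _≤_; _<_; _<ᵇ_; z≤n; s≤s; _≤?_; _<?_)
open import Data.Nat.ListAction using (sum)
open import Data.Nat.ListAction.Properties using (sum-↭)
open import Data.Nat.Properties hiding (_≟_)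
open import Algebra.Properties.CommutativeSemigroup +-commutativeSemigroup
  using () renaming (interchange to +-interchange)
open import Data.Nat.Tactic.RingSolver using (solve-∀)
open import Data.Product using (_×_; _,_; proj₁; proj₂; ∃₂)
open import Data.Sum using (inj₁; inj₂)
open import Function using (_∘_)
open import Function.Bundles using (mk⇔)
open import Relation.Binary.Definitions using (tri<; tri≈; tri>)
open import Relation.Binary.PropositionalEquality
import Relation.Binary.Reasoning.Setoid as SetoidReasoning
open import Relation.Nullary using (¬_)

-- Convolution of sequences and linear recurrences

module ≗-Reasoning = SetoidReasoning (ℕ →-setoid ℕ)

antidiagonal : (ℕ → ℕ → ℕ) → ℕ → ℕ
antidiagonal G zero    = G 0 0
antidiagonal G (suc n) = G 0 (suc n) + antidiagonal (λ i j → G (suc i) j) n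

infixl 7 _⋆_
infixl 6 _⊕_

_⋆_ : (ℕ → ℕ) → (ℕ → ℕ) → ℕ → ℕ
f ⋆ g = antidiagonal (λ i j → f i * g j)

_⊕_ : (ℕ → ℕ) → (ℕ → ℕ) → ℕ → ℕ
(f ⊕ g) n = f n + g n

antidiagonal-cong : ∀ {G H} n → (∀ i j → i + j ≡ n → G i j ≡ H i j) →
                    antidiagonal G n ≡ antidiagonal H n
antidiagonal-cong zero    G≡H = G≡H 0 0 refl
antidiagonal-cong (suc n) G≡H =
  cong₂ _+_ (G≡H 0 (suc n) refl) (antidiagonal-cong n (λ i j e → G≡H (suc i) j (cong suc e)))

antidiagonal-+ : ∀ G H n → antidiagonal (λ i j → G i j + H i j) n ≡ antidiagonal G n + antidiagonal H n
antidiagonal-+ G H zero    = refl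
antidiagonal-+ G H (suc n) =
  trans (cong (G 0 (suc n) + H 0 (suc n) +_) (antidiagonal-+ _ _ n))
        (+-interchange (G 0 (suc n)) (H 0 (suc n)) _ _)

antidiagonal-*ˡ : ∀ c G n → antidiagonal (λ i j → c * G i j) n ≡ c * antidiagonal G n
antidiagonal-*ˡ c G zero    = refl
antidiagonal-*ˡ c G (suc n) =
  trans (cong (c * G 0 (suc n) +_) (antidiagonal-*ˡ c _ n)) (sym (*-distribˡ-+ c (G 0 (suc n)) _))

antidiagonal-last : ∀ G n → antidiagonal G (suc n) ≡ antidiagonal (λ i j → G i (suc j)) n + G (suc n) 0
antidiagonal-last G zero    = refl
antidiagonal-last G (suc n) =
  trans (cong (G 0 (suc (suc n)) +_) (antidiagonal-last (λ i j → G (suc i) j) n))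
        (sym (+-assoc (G 0 (suc (suc n))) _ _))

antidiagonal-flip : ∀ G n → antidiagonal G n ≡ antidiagonal (λ i j → G j i) n
antidiagonal-flip G zero    = refl
antidiagonal-flip G (suc n) =
  trans (cong (G 0 (suc n) +_) (antidiagonal-flip (λ i j → G (suc i) j) n))
        (trans (+-comm (G 0 (suc n)) _) (sym (antidiagonal-last (λ i j → G j i) n)))

⋆-comm : ∀ f g → f ⋆ g ≗ g ⋆ f
⋆-comm f g n = trans (antidiagonal-flip _ n) (antidiagonal-cong n (λ i j _ → *-comm (f j) (g i)))

⋆-distribˡ-⊕ : ∀ f g h → f ⋆ (g ⊕ h) ≗ f ⋆ g ⊕ f ⋆ h
⋆-distribˡ-⊕ f g h n =
  trans (antidiagonal-cong n (λ i j _ → *-distribˡ-+ (f i) (g j) (h j))) (antidiagonal-+ _ _ n)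

⋆-distribʳ-⊕ : ∀ f g h → (g ⊕ h) ⋆ f ≗ g ⋆ f ⊕ h ⋆ f
⋆-distribʳ-⊕ f g h n =
  trans (antidiagonal-cong n (λ i j _ → *-distribʳ-+ (f j) (g i) (h i))) (antidiagonal-+ _ _ n)

⋆-congˡ-≤ : ∀ {f f′} g n → (∀ i → i ≤ n → f i ≡ f′ i) → (f ⋆ g) n ≡ (f′ ⋆ g) n
⋆-congˡ-≤ g n f≡f′ =
  antidiagonal-cong n (λ i j i+j≡n → cong (_* g j) (f≡f′ i (subst (i ≤_) i+j≡n (m≤m+n i j))))

⋆-congʳ-≤ : ∀ f {g g′} n → (∀ j → j ≤ n → g j ≡ g′ j) → (f ⋆ g) n ≡ (f ⋆ g′) n
⋆-congʳ-≤ f n g≡g′ =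
  antidiagonal-cong n (λ i j i+j≡n → cong (f i *_) (g≡g′ j (subst (j ≤_) i+j≡n (m≤n+m j i))))

⋆-cong : ∀ {f f′ g g′} → f ≗ f′ → g ≗ g′ → f ⋆ g ≗ f′ ⋆ g′
⋆-cong {f′ = f′} {g = g} f≗f′ g≗g′ n =
  trans (⋆-congˡ-≤ g n (λ i _ → f≗f′ i)) (⋆-congʳ-≤ f′ n (λ j _ → g≗g′ j))

⋆-congʳ : ∀ f {g g′} → g ≗ g′ → f ⋆ g ≗ f ⋆ g′
⋆-congʳ f g≗g′ n = ⋆-congʳ-≤ f n (λ j _ → g≗g′ j)

⋆-assoc : ∀ f g h → (f ⋆ g) ⋆ h ≗ f ⋆ (g ⋆ h)
⋆-assoc f g h zero    = *-assoc (f 0) (g 0) (h 0)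
⋆-assoc f g h (suc n) = begin
    (f 0 * g 0) * h (suc n) + antidiagonal (λ i j → (f ⋆ g) (suc i) * h j) n
  ≡⟨ cong ((f 0 * g 0) * h (suc n) +_) split ⟩
    (f 0 * g 0) * h (suc n) + (f 0 * (g ∘ suc ⋆ h) n + (f ∘ suc ⋆ (g ⋆ h)) n)
  ≡⟨ regroup (f 0) (g 0) (h (suc n)) _ _ ⟩
    f 0 * (g 0 * h (suc n) + (g ∘ suc ⋆ h) n) + (f ∘ suc ⋆ (g ⋆ h)) n ∎
  where
  open ≡-Reasoning
  regroup : ∀ a b c x y → (a * b) * c + (a * x + y) ≡ a * (b * c + x) + y
  regroup = solve-∀
  split : antidiagonal (λ i j → (f ⋆ g) (suc i) * h j) n ≡ f 0 * (g ∘ suc ⋆ h) n + (f ∘ suc ⋆ (g ⋆ h)) n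
  split = begin
      antidiagonal (λ i j → (f 0 * g (suc i) + (f ∘ suc ⋆ g) i) * h j) n
    ≡⟨ antidiagonal-cong n (λ i j _ →
         trans (*-distribʳ-+ (h j) (f 0 * g (suc i)) ((f ∘ suc ⋆ g) i))
               (cong (_+ (f ∘ suc ⋆ g) i * h j) (*-assoc (f 0) (g (suc i)) (h j)))) ⟩
      antidiagonal (λ i j → f 0 * (g (suc i) * h j) + (f ∘ suc ⋆ g) i * h j) n
    ≡⟨ antidiagonal-+ (λ i j → f 0 * (g (suc i) * h j)) (λ i j → (f ∘ suc ⋆ g) i * h j) n ⟩
      antidiagonal (λ i j → f 0 * (g (suc i) * h j)) n + ((f ∘ suc ⋆ g) ⋆ h) n
    ≡⟨ cong₂ _+_ (antidiagonal-*ˡ (f 0) (λ i j → g (suc i) * h j) n) (⋆-assoc (f ∘ suc) g h n) ⟩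
      f 0 * (g ∘ suc ⋆ h) n + (f ∘ suc ⋆ (g ⋆ h)) n ∎

⋆-leftComm : ∀ f g h → f ⋆ (g ⋆ h) ≗ g ⋆ (f ⋆ h)
⋆-leftComm f g h = begin
  f ⋆ (g ⋆ h)  ≈⟨ (λ n → sym (⋆-assoc f g h n)) ⟩
  (f ⋆ g) ⋆ h  ≈⟨ ⋆-cong (⋆-comm f g) (λ _ → refl) ⟩
  (g ⋆ f) ⋆ h  ≈⟨ ⋆-assoc g f h ⟩
  g ⋆ (f ⋆ h)  ∎
  where open ≗-Reasoning

⋆-suc : ∀ f g n → g 0 ≡ 0 → (f ⋆ g) (suc n) ≡ (f ⋆ (g ∘ suc)) n
⋆-suc f g n g₀ = begin
  (f ⋆ g) (suc n)                       ≡⟨ antidiagonal-last (λ i j → f i * g j) n ⟩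
  (f ⋆ (g ∘ suc)) n + f (suc n) * g 0   ≡⟨ cong (λ x → (f ⋆ (g ∘ suc)) n + f (suc n) * x) g₀ ⟩
  (f ⋆ (g ∘ suc)) n + f (suc n) * 0     ≡⟨ cong ((f ⋆ (g ∘ suc)) n +_) (*-zeroʳ (f (suc n))) ⟩
  (f ⋆ (g ∘ suc)) n + 0                 ≡⟨ +-identityʳ _ ⟩
  (f ⋆ (g ∘ suc)) n                     ∎
  where open ≡-Reasoning

record Recurrence (C V Z : ℕ → ℕ) : Set where
  constructor recurrence
  field step : ∀ n → Z (suc n) ≡ (Z ⋆ C ⊕ C ⋆ Z ⊕ V) n

open Recurrence

recurrence-unique : ∀ {C V Z Z′} → Recurrence C V Z → Recurrence C V Z′ → Z 0 ≡ Z′ 0 → Z ≗ Z′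
recurrence-unique {C} {V} {Z} {Z′} (recurrence Z-rec) (recurrence Z′-rec) Z₀≡Z′₀ n = agreeUpTo n n ≤-refl
  where
  agreeUpTo : ∀ m k → k ≤ m → Z k ≡ Z′ k
  agreeUpTo _       zero    _         = Z₀≡Z′₀
  agreeUpTo (suc m) (suc k) (s≤s k≤m) = begin
    Z (suc k)                          ≡⟨ Z-rec k ⟩
    (Z ⋆ C) k + (C ⋆ Z) k + V k        ≡⟨ cong₂ (λ x y → x + y + V k)
                                              (⋆-congˡ-≤ C k agree) (⋆-congʳ-≤ C k agree) ⟩
    (Z′ ⋆ C) k + (C ⋆ Z′) k + V k      ≡⟨ Z′-rec k ⟨
    Z′ (suc k)                         ∎
    where
    open ≡-Reasoning
    agree : ∀ i → i ≤ k → Z i ≡ Z′ i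
    agree i i≤k = agreeUpTo m i (≤-trans i≤k k≤m)

recurrence-resp : ∀ {C V V′ Z} → V ≗ V′ → Recurrence C V Z → Recurrence C V′ Z
recurrence-resp V≗V′ Z-rec = recurrence λ n → trans (step Z-rec n) (cong (_ +_) (V≗V′ n))

recurrence-⊕ : ∀ {C V V′ Z Z′} → Recurrence C V Z → Recurrence C V′ Z′ →
               Recurrence C (V ⊕ V′) (Z ⊕ Z′)
recurrence-⊕ {C} {V} {V′} {Z} {Z′} Z-rec Z′-rec = recurrence λ n → begin
  Z (suc n) + Z′ (suc n)
    ≡⟨ cong₂ _+_ (step Z-rec n) (step Z′-rec n) ⟩
  ((Z ⋆ C) n + (C ⋆ Z) n + V n) + ((Z′ ⋆ C) n + (C ⋆ Z′) n + V′ n)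
    ≡⟨ regroup ((Z ⋆ C) n) _ _ _ _ _ ⟩
  ((Z ⋆ C) n + (Z′ ⋆ C) n) + ((C ⋆ Z) n + (C ⋆ Z′) n) + (V n + V′ n)
    ≡⟨ cong₂ (λ x y → x + y + (V n + V′ n)) (⋆-distribʳ-⊕ C Z Z′ n) (⋆-distribˡ-⊕ C Z Z′ n) ⟨
  ((Z ⊕ Z′) ⋆ C) n + (C ⋆ (Z ⊕ Z′)) n + (V n + V′ n) ∎
  where
  open ≡-Reasoning
  regroup : ∀ a b c a′ b′ c′ → (a + b + c) + (a′ + b′ + c′) ≡ (a + a′) + (b + b′) + (c + c′)
  regroup = solve-∀

recurrence-⋆ : ∀ {C V Z} W → Z 0 ≡ 0 → Recurrence C V Z → Recurrence C (W ⋆ V) (W ⋆ Z)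
recurrence-⋆ {C} {V} {Z} W Z₀ Z-rec = recurrence λ n → begin
  (W ⋆ Z) (suc n)                                ≡⟨ ⋆-suc W Z n Z₀ ⟩
  (W ⋆ (Z ∘ suc)) n                              ≡⟨ ⋆-congʳ-≤ W n (λ k _ → step Z-rec k) ⟩
  (W ⋆ (Z ⋆ C ⊕ C ⋆ Z ⊕ V)) n                    ≡⟨ ⋆-distribˡ-⊕ W _ V n ⟩
  (W ⋆ (Z ⋆ C ⊕ C ⋆ Z)) n + (W ⋆ V) n            ≡⟨ cong (_+ (W ⋆ V) n) (⋆-distribˡ-⊕ W _ _ n) ⟩
  (W ⋆ (Z ⋆ C)) n + (W ⋆ (C ⋆ Z)) n + (W ⋆ V) n  ≡⟨ cong₂ (λ x y → x + y + (W ⋆ V) n)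
                                                       (⋆-assoc W Z C n) (⋆-leftComm C W Z n) ⟨
  ((W ⋆ Z) ⋆ C) n + (C ⋆ (W ⋆ Z)) n + (W ⋆ V) n  ∎
  where open ≡-Reasoning

weighted : (ℕ → ℕ) → ℕ → ℕ
weighted C n = n * C n

-- C, A, I are the sequences of the same names in the header.
module CatalanConvolutions
  (C A I : ℕ → ℕ)
  (C-rec : ∀ n → C (suc n) ≡ (C ⋆ C) n)
  (A₀ : A 0 ≡ 0) (A-rec : Recurrence C (weighted C ⋆ C) A)
  (I₀ : I 0 ≡ 0) (I-rec : Recurrence C ((C ⊕ weighted C) ⋆ weighted C) I)
  where

  E : ℕ → ℕ
  E = weighted C

  E-rec : Recurrence C (C ⋆ C) E
  E-rec = recurrence λ n → begin
    suc n * C (suc n)                              ≡⟨ cong (suc n *_) (C-rec n) ⟩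
    (C ⋆ C) n + n * (C ⋆ C) n                      ≡⟨ cong ((C ⋆ C) n +_) (antidiagonal-*ˡ n _ n) ⟨
    (C ⋆ C) n + antidiagonal (λ i j → n * (C i * C j)) n
      ≡⟨ cong ((C ⋆ C) n +_) (antidiagonal-cong n λ i j i+j≡n →
           trans (cong (_* (C i * C j)) (sym i+j≡n)) (split i j (C i) (C j))) ⟩
    (C ⋆ C) n + antidiagonal (λ i j → E i * C j + C i * E j) n
      ≡⟨ cong ((C ⋆ C) n +_) (antidiagonal-+ (λ i j → E i * C j) (λ i j → C i * E j) n) ⟩
    (C ⋆ C) n + ((E ⋆ C) n + (C ⋆ E) n)            ≡⟨ rotate ((C ⋆ C) n) ((E ⋆ C) n) ((C ⋆ E) n) ⟩
    (E ⋆ C) n + (C ⋆ E) n + (C ⋆ C) n              ∎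
    where
    open ≡-Reasoning
    split : ∀ i j a b → (i + j) * (a * b) ≡ (i * a) * b + a * (j * b)
    split = solve-∀
    rotate : ∀ a b c → a + (b + c) ≡ b + c + a
    rotate = solve-∀

  C⋆A≗E⋆E : C ⋆ A ≗ E ⋆ E
  C⋆A≗E⋆E = recurrence-unique C⋆A-rec E⋆E-rec (trans (cong (C 0 *_) A₀) (*-zeroʳ (C 0)))
    where
    C⋆A-rec : Recurrence C (C ⋆ (E ⋆ C)) (C ⋆ A)
    C⋆A-rec = recurrence-⋆ C A₀ A-rec
    E⋆E-rec : Recurrence C (C ⋆ (E ⋆ C)) (E ⋆ E)
    E⋆E-rec = recurrence-resp (⋆-leftComm E C C) (recurrence-⋆ E refl E-rec)

  -- the common value of V_213, V_312 and V_231
  U : ℕ → ℕ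
  U = E ⋆ A ⊕ C ⋆ A

  I⋆C≗U : I ⋆ C ≗ U
  I⋆C≗U n = trans (⋆-comm I C n)
    (recurrence-unique C⋆I-rec U-rec (trans (cong (C 0 *_) I₀) (sym (cong (C 0 *_) A₀))) n)
    where
    open ≗-Reasoning
    V : ℕ → ℕ
    V = E ⋆ (E ⋆ C) ⊕ C ⋆ (E ⋆ C)
    V≗ : C ⋆ ((C ⊕ E) ⋆ E) ≗ V
    V≗ = begin
      C ⋆ ((C ⊕ E) ⋆ E)              ≈⟨ ⋆-congʳ C (⋆-distribʳ-⊕ E C E) ⟩
      C ⋆ (C ⋆ E ⊕ E ⋆ E)            ≈⟨ ⋆-distribˡ-⊕ C (C ⋆ E) (E ⋆ E) ⟩
      C ⋆ (C ⋆ E) ⊕ C ⋆ (E ⋆ E)      ≈⟨ (λ n → +-comm ((C ⋆ (C ⋆ E)) n) _) ⟩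
      C ⋆ (E ⋆ E) ⊕ C ⋆ (C ⋆ E)      ≈⟨ (λ n → cong₂ _+_ (⋆-leftComm C E E n) (⋆-congʳ C (⋆-comm C E) n)) ⟩
      E ⋆ (C ⋆ E) ⊕ C ⋆ (E ⋆ C)      ≈⟨ (λ n → cong (_+ (C ⋆ (E ⋆ C)) n) (⋆-congʳ E (⋆-comm C E) n)) ⟩
      V                              ∎
    C⋆I-rec : Recurrence C V (C ⋆ I)
    C⋆I-rec = recurrence-resp V≗ (recurrence-⋆ C I₀ I-rec)
    U-rec : Recurrence C V U
    U-rec = recurrence-⊕ (recurrence-⋆ E A₀ A-rec) (recurrence-⋆ C A₀ A-rec)

  [C⊕E]⋆A≗U : (C ⊕ E) ⋆ A ≗ U
  [C⊕E]⋆A≗U n = trans (⋆-distribʳ-⊕ A C E n) (+-comm ((C ⋆ A) n) _)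

  [A⊕E]⋆E≗U : (A ⊕ E) ⋆ E ≗ U
  [A⊕E]⋆E≗U n = trans (⋆-distribʳ-⊕ E A E n)
                      (cong₂ _+_ (⋆-comm A E n) (sym (C⋆A≗E⋆E n)))

-- Sums over lists and copies of patterns

private variable A B : Set

∑ : List A → (A → ℕ) → ℕ
∑ xs f = sum (map f xs)

infix 5 ∑
syntax ∑ xs (λ x → e) = ∑[ x ∈ xs ] e


∑-++ : ∀ (xs ys : List A) f → ∑ (xs ++ ys) f ≡ ∑ xs f + ∑ ys f
∑-++ []       ys f = refl
∑-++ (x ∷ xs) ys f = trans (cong (f x +_) (∑-++ xs ys f)) (sym (+-assoc (f x) _ _))

∑-cong : ∀ (xs : List A) {f g} → (∀ {x} → x ∈ xs → f x ≡ g x) → ∑ xs f ≡ ∑ xs g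
∑-cong []       f≡g = refl
∑-cong (x ∷ xs) f≡g = cong₂ _+_ (f≡g (here refl)) (∑-cong xs (f≡g ∘ there))

∑-+ : ∀ (xs : List A) f g → ∑[ x ∈ xs ] (f x + g x) ≡ ∑ xs f + ∑ xs g
∑-+ []       f g = refl
∑-+ (x ∷ xs) f g = trans (cong (f x + g x +_) (∑-+ xs f g)) (+-interchange (f x) (g x) _ _)

∑-*ˡ : ∀ (xs : List A) c f → ∑[ x ∈ xs ] (c * f x) ≡ c * ∑ xs f
∑-*ˡ []       c f = sym (*-zeroʳ c)
∑-*ˡ (x ∷ xs) c f = trans (cong (c * f x +_) (∑-*ˡ xs c f)) (sym (*-distribˡ-+ c (f x) _))

∑-*ʳ : ∀ (xs : List A) c f → ∑[ x ∈ xs ] (f x * c) ≡ ∑ xs f * c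
∑-*ʳ xs c f = trans (∑-cong xs λ {x} _ → *-comm (f x) c) (trans (∑-*ˡ xs c f) (*-comm c _))

∑-0 : ∀ (xs : List A) → ∑[ x ∈ xs ] 0 ≡ 0
∑-0 []       = refl
∑-0 (x ∷ xs) = ∑-0 xs

∑-↭ : ∀ {xs ys : List A} f → xs ↭ ys → ∑ xs f ≡ ∑ ys f
∑-↭ f xs↭ys = sum-↭ (map⁺ f xs↭ys)

∑-map : ∀ (g : A → B) xs f → ∑ (map g xs) f ≡ ∑ xs (f ∘ g)
∑-map g []       f = refl
∑-map g (x ∷ xs) f = cong (f (g x) +_) (∑-map g xs f)

∑-concatMap : ∀ (g : A → List B) xs f → ∑ (concatMap g xs) f ≡ ∑[ x ∈ xs ] ∑ (g x) f
∑-concatMap g []       f = refl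
∑-concatMap g (x ∷ xs) f = trans (∑-++ (g x) _ f) (cong (∑ (g x) f +_) (∑-concatMap g xs f))

∑-comm : ∀ (xs : List A) (ys : List B) (F : A → B → ℕ) →
         ∑[ x ∈ xs ] ∑[ y ∈ ys ] F x y ≡ ∑[ y ∈ ys ] ∑[ x ∈ xs ] F x y
∑-comm []       ys F = sym (∑-0 ys)
∑-comm (x ∷ xs) ys F = trans (cong (∑ ys (F x) +_) (∑-comm xs ys F)) (sym (∑-+ ys (F x) _))

∑∑-* : ∀ (xs : List A) (ys : List B) (f : A → ℕ) (g : B → ℕ) →
       ∑[ x ∈ xs ] ∑[ y ∈ ys ] (f x * g y) ≡ ∑ xs f * ∑ ys g
∑∑-* xs ys f g = trans (∑-cong xs λ {x} _ → ∑-*ˡ ys (f x) g) (∑-*ʳ xs (∑ ys g) f)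

𝟙 : Bool → ℕ
𝟙 b = if b then 1 else 0

𝟙-∧ : ∀ a b → 𝟙 (a ∧ b) ≡ 𝟙 a * 𝟙 b
𝟙-∧ true  true  = refl
𝟙-∧ true  false = refl
𝟙-∧ false b     = refl

length-filter-true : ∀ (f : A → Bool) xs →
                     length (filter (λ x → f x ≟ true) xs) ≡ ∑[ x ∈ xs ] 𝟙 (f x)
length-filter-true f []       = refl
length-filter-true f (x ∷ xs) with f x
... | true  = cong suc (length-filter-true f xs)
... | false = length-filter-true f xs

copies-∑ : ∀ p q → copies p q ≡ ∑[ s ∈ subseqs p ] 𝟙 (orderIso s q)
copies-∑ p q = length-filter-true (λ s → orderIso s q) (subseqs p)

∑-subseqs-++ : ∀ xs ys h → ∑ (subseqs (xs ++ ys)) h ≡ ∑[ a ∈ subseqs xs ] ∑[ b ∈ subseqs ys ] h (a ++ b)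
∑-subseqs-++ []       ys h = sym (+-identityʳ _)
∑-subseqs-++ (x ∷ xs) ys h = begin
  ∑ (map (x ∷_) (subseqs (xs ++ ys)) ++ subseqs (xs ++ ys)) h
    ≡⟨ ∑-++ (map (x ∷_) (subseqs (xs ++ ys))) _ h ⟩
  ∑ (map (x ∷_) (subseqs (xs ++ ys))) h + ∑ (subseqs (xs ++ ys)) h
    ≡⟨ cong₂ _+_ (trans (∑-map (x ∷_) (subseqs (xs ++ ys)) h) (∑-subseqs-++ xs ys (h ∘ (x ∷_))))
                 (∑-subseqs-++ xs ys h) ⟩
  (∑[ a ∈ subseqs xs ] F (x ∷ a)) + ∑ (subseqs xs) F
    ≡⟨ cong (_+ ∑ (subseqs xs) F) (∑-map (x ∷_) (subseqs xs) F) ⟨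
  ∑ (map (x ∷_) (subseqs xs)) F + ∑ (subseqs xs) F
    ≡⟨ ∑-++ (map (x ∷_) (subseqs xs)) _ F ⟨
  ∑ (map (x ∷_) (subseqs xs) ++ subseqs xs) F ∎
  where
  open ≡-Reasoning
  F : List ℕ → ℕ
  F a = ∑[ b ∈ subseqs ys ] h (a ++ b)

subseqs-map : ∀ (f : ℕ → ℕ) xs → subseqs (map f xs) ≡ map (map f) (subseqs xs)
subseqs-map f []       = refl
subseqs-map f (x ∷ xs) rewrite subseqs-map f xs = begin
  map (f x ∷_) (map (map f) (subseqs xs)) ++ map (map f) (subseqs xs)
    ≡⟨ cong (_++ map (map f) (subseqs xs)) (trans (sym (map-∘ (subseqs xs))) (map-∘ (subseqs xs))) ⟩
  map (map f) (map (x ∷_) (subseqs xs)) ++ map (map f) (subseqs xs)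
    ≡⟨ map-++ (map f) (map (x ∷_) (subseqs xs)) (subseqs xs) ⟨
  map (map f) (map (x ∷_) (subseqs xs) ++ subseqs xs) ∎
  where open ≡-Reasoning

All-subseqs : ∀ {P : ℕ → Set} {xs s} → All P xs → s ∈ subseqs xs → All P s
All-subseqs {xs = []}     []         (here refl) = []
All-subseqs {xs = x ∷ xs} (px ∷ pxs) s∈ with ∈-++⁻ (map (x ∷_) (subseqs xs)) s∈
... | inj₂ s∈′ = All-subseqs pxs s∈′
... | inj₁ s∈′ with ∈-map⁻ (x ∷_) s∈′
...   | t , t∈ , refl = px ∷ All-subseqs pxs t∈

<ᵇ-translate : ∀ k x y → (k + x <ᵇ k + y) ≡ (x <ᵇ y)
<ᵇ-translate zero    x y = refl
<ᵇ-translate (suc k) x y = <ᵇ-translate k x y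

compat-translate : ∀ k x a ys bs → compat (k + x) a (map (k +_) ys) bs ≡ compat x a ys bs
compat-translate k x a []       []       = refl
compat-translate k x a []       (b ∷ bs) = refl
compat-translate k x a (y ∷ ys) []       = refl
compat-translate k x a (y ∷ ys) (b ∷ bs)
  rewrite <ᵇ-translate k x y | <ᵇ-translate k y x | compat-translate k x a ys bs = refl

orderIso-translate : ∀ k s q → orderIso (map (k +_) s) q ≡ orderIso s q
orderIso-translate k []      []      = refl
orderIso-translate k []      (_ ∷ _) = refl
orderIso-translate k (_ ∷ _) []      = refl
orderIso-translate k (x ∷ s) (a ∷ q) rewrite compat-translate k x a s q | orderIso-translate k s q = refl

copies-translate : ∀ k p q → copies (map (k +_) p) q ≡ copies p q
copies-translate k p q = begin
  copies (map (k +_) p) q                                   ≡⟨ copies-∑ (map (k +_) p) q ⟩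
  ∑[ s ∈ subseqs (map (k +_) p) ] 𝟙 (orderIso s q)          ≡⟨ cong (λ S → ∑ S _) (subseqs-map (k +_) p) ⟩
  ∑[ s ∈ map (map (k +_)) (subseqs p) ] 𝟙 (orderIso s q)    ≡⟨ ∑-map (map (k +_)) (subseqs p) _ ⟩
  ∑[ s ∈ subseqs p ] 𝟙 (orderIso (map (k +_) s) q)          ≡⟨ ∑-cong (subseqs p) (λ {s} _ → cong 𝟙 (orderIso-translate k s q)) ⟩
  ∑[ s ∈ subseqs p ] 𝟙 (orderIso s q)                       ≡⟨ copies-∑ p q ⟨
  copies p q                                                ∎
  where open ≡-Reasoning

copies-[] : ∀ p → copies p [] ≡ 1
copies-[] p = trans (copies-∑ p []) (onlyEmpty p)
  where
  onlyEmpty : ∀ p → ∑[ s ∈ subseqs p ] 𝟙 (orderIso s []) ≡ 1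
  onlyEmpty []      = refl
  onlyEmpty (x ∷ p) = begin
    ∑ (map (x ∷_) (subseqs p) ++ subseqs p) (λ s → 𝟙 (orderIso s []))
      ≡⟨ ∑-++ (map (x ∷_) (subseqs p)) _ _ ⟩
    ∑ (map (x ∷_) (subseqs p)) (λ s → 𝟙 (orderIso s [])) + (∑[ s ∈ subseqs p ] 𝟙 (orderIso s []))
      ≡⟨ cong₂ _+_ (trans (∑-map (x ∷_) (subseqs p) _) (∑-0 (subseqs p))) (onlyEmpty p) ⟩
    1 ∎
    where open ≡-Reasoning

copies-[-] : ∀ p v → copies p (v ∷ []) ≡ length p
copies-[-] p v = trans (copies-∑ p _) (singletons p)
  where
  singletons : ∀ p → ∑[ s ∈ subseqs p ] 𝟙 (orderIso s (v ∷ [])) ≡ length p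
  singletons []      = refl
  singletons (x ∷ p) = begin
    ∑ (map (x ∷_) (subseqs p) ++ subseqs p) (λ s → 𝟙 (orderIso s (v ∷ [])))
      ≡⟨ ∑-++ (map (x ∷_) (subseqs p)) _ _ ⟩
    ∑ (map (x ∷_) (subseqs p)) (λ s → 𝟙 (orderIso s (v ∷ []))) + (∑[ s ∈ subseqs p ] 𝟙 (orderIso s (v ∷ [])))
      ≡⟨ cong₂ _+_ (trans (∑-map (x ∷_) (subseqs p) _)
                     (trans (∑-cong (subseqs p) λ {s} _ → onlyEmpty s) (trans (sym (copies-∑ p [])) (copies-[] p))))
                   (singletons p) ⟩
    suc (length p) ∎
    where
    open ≡-Reasoning
    onlyEmpty : ∀ s → 𝟙 (orderIso (x ∷ s) (v ∷ [])) ≡ 𝟙 (orderIso s [])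
    onlyEmpty []      = refl
    onlyEmpty (_ ∷ _) = refl

ComparesAs : Bool → ℕ → ℕ → Set
ComparesAs d x y = (x <ᵇ y) ≡ d × (y <ᵇ x) ≡ not d

-- shaped like compat, which it equals when x compares with the entries as d (compat-comparesAll)
comparesAllᵇ : Bool → ℕ → List ℕ → Bool
comparesAllᵇ d u []       = true
comparesAllᵇ d u (v ∷ vs) = (d == (u <ᵇ v)) ∧ ((not d) == (v <ᵇ u)) ∧ comparesAllᵇ d u vs

crossesᵇ : Bool → List ℕ → List ℕ → Bool
crossesᵇ d []       vs = true
crossesᵇ d (u ∷ us) vs = comparesAllᵇ d u vs ∧ crossesᵇ d us vs

consˡ : ℕ → List ℕ × List ℕ → List ℕ × List ℕ
consˡ u (q₁ , q₂) = u ∷ q₁ , q₂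

splits : List ℕ → List (List ℕ × List ℕ)
splits []      = ([] , []) ∷ []
splits (u ∷ q) = ([] , u ∷ q) ∷ map (consˡ u) (splits q)

splits-++ : ∀ q {q₁ q₂} → (q₁ , q₂) ∈ splits q → q₁ ++ q₂ ≡ q
splits-++ []      (here refl) = refl
splits-++ (u ∷ q) (here refl) = refl
splits-++ (u ∷ q) (there s∈) with ∈-map⁻ _ s∈
... | _ , s′∈ , refl = cong (u ∷_) (splits-++ q s′∈)

orderIso-length : ∀ s q → orderIso s q ≡ true → length s ≡ length q
orderIso-length []      []      _ = refl
orderIso-length (x ∷ s) (a ∷ q) e with compat x a s q
... | true = cong suc (orderIso-length s q e)

compat-++ : ∀ x u a q₁ b q₂ → length a ≡ length q₁ →
            compat x u (a ++ b) (q₁ ++ q₂) ≡ (compat x u a q₁ ∧ compat x u b q₂)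
compat-++ x u []      []       b q₂ _ = refl
compat-++ x u (y ∷ a) (v ∷ q₁) b q₂ e
  rewrite compat-++ x u a q₁ b q₂ (suc-injective e)
        | ∧-assoc ((x <ᵇ y) == (u <ᵇ v)) ((y <ᵇ x) == (v <ᵇ u) ∧ compat x u a q₁) (compat x u b q₂)
        | ∧-assoc ((y <ᵇ x) == (v <ᵇ u)) (compat x u a q₁) (compat x u b q₂) = refl

compat-comparesAll : ∀ d x u b q₂ → All (ComparesAs d x) b → length b ≡ length q₂ →
                     compat x u b q₂ ≡ comparesAllᵇ d u q₂
compat-comparesAll d x u []      []       _              _ = refl
compat-comparesAll d x u (y ∷ b) (v ∷ q₂) ((e₁ , e₂) ∷ h) e
  rewrite e₁ | e₂ | compat-comparesAll d x u b q₂ h (suc-injective e) = refl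

splitTerm : Bool → List ℕ → List ℕ → List ℕ × List ℕ → ℕ
splitTerm d a b (q₁ , q₂) = 𝟙 (orderIso a q₁) * (𝟙 (orderIso b q₂) * 𝟙 (crossesᵇ d q₁ q₂))

orderIso-++ : ∀ d a b → All (λ x → All (ComparesAs d x) b) a → ∀ q →
              𝟙 (orderIso (a ++ b) q) ≡ ∑ (splits q) (splitTerm d a b)
orderIso-++ d []      b _ []      = sym (trans (+-identityʳ _) (trans (*-identityˡ _) (*-identityʳ _)))
orderIso-++ d []      b _ (u ∷ q) = sym (begin
  1 * (𝟙 (orderIso b (u ∷ q)) * 1) + ∑ (map (consˡ u) (splits q)) (splitTerm d [] b)
    ≡⟨ cong (1 * (𝟙 (orderIso b (u ∷ q)) * 1) +_) (trans (∑-map (consˡ u) (splits q) _) (∑-0 (splits q))) ⟩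
  1 * (𝟙 (orderIso b (u ∷ q)) * 1) + 0
    ≡⟨ trans (+-identityʳ _) (trans (*-identityˡ _) (*-identityʳ _)) ⟩
  𝟙 (orderIso b (u ∷ q)) ∎)
  where open ≡-Reasoning
orderIso-++ d (x ∷ a) b _          []      = refl
orderIso-++ d (x ∷ a) b (hx ∷ hab) (u ∷ q) = begin
  𝟙 (compat x u (a ++ b) q ∧ orderIso (a ++ b) q)
    ≡⟨ 𝟙-∧ (compat x u (a ++ b) q) _ ⟩
  𝟙 (compat x u (a ++ b) q) * 𝟙 (orderIso (a ++ b) q)
    ≡⟨ cong (𝟙 (compat x u (a ++ b) q) *_) (orderIso-++ d a b hab q) ⟩
  𝟙 (compat x u (a ++ b) q) * ∑ (splits q) (splitTerm d a b)
    ≡⟨ ∑-*ˡ (splits q) (𝟙 (compat x u (a ++ b) q)) (splitTerm d a b) ⟨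
  ∑[ s ∈ splits q ] (𝟙 (compat x u (a ++ b) q) * splitTerm d a b s)
    ≡⟨ ∑-cong (splits q) extendTerm ⟩
  ∑[ s ∈ splits q ] splitTerm d (x ∷ a) b (consˡ u s)
    ≡⟨ ∑-map (consˡ u) (splits q) (splitTerm d (x ∷ a) b) ⟨
  ∑ (map (consˡ u) (splits q)) (splitTerm d (x ∷ a) b) ∎
  where
  open ≡-Reasoning
  -- c is compat x u (a ++ b) q, which splits as c₁ ∧ e once both parts are order-isomorphic
  absorb : ∀ c c₁ o₁ o₂ e r → (o₁ ≡ true → o₂ ≡ true → c ≡ (c₁ ∧ e)) →
           𝟙 c * (𝟙 o₁ * (𝟙 o₂ * 𝟙 r)) ≡ 𝟙 (c₁ ∧ o₁) * (𝟙 o₂ * 𝟙 (e ∧ r))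
  absorb c c₁ false o₂   e r _ rewrite ∧-zeroʳ c₁ = *-zeroʳ (𝟙 c)
  absorb c c₁ true false e r _ = trans (*-zeroʳ (𝟙 c)) (sym (*-zeroʳ (𝟙 (c₁ ∧ true))))
  absorb c c₁ true true  e r h rewrite h refl refl = lemma c₁ e r
    where
    lemma : ∀ c₁ e r → 𝟙 (c₁ ∧ e) * (1 * (1 * 𝟙 r)) ≡ 𝟙 (c₁ ∧ true) * (1 * 𝟙 (e ∧ r))
    lemma true  true  true  = refl
    lemma true  true  false = refl
    lemma true  false r     = refl
    lemma false e     r     = refl
  extendTerm : ∀ {s} → s ∈ splits q → 𝟙 (compat x u (a ++ b) q) * splitTerm d a b s ≡ splitTerm d (x ∷ a) b (consˡ u s)
  extendTerm {q₁ , q₂} s∈ =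
    absorb _ (compat x u a q₁) (orderIso a q₁) (orderIso b q₂) (comparesAllᵇ d u q₂) _ λ a≅q₁ b≅q₂ → begin
    compat x u (a ++ b) q                              ≡⟨ cong (compat x u (a ++ b)) (splits-++ q s∈) ⟨
    compat x u (a ++ b) (q₁ ++ q₂)                     ≡⟨ compat-++ x u a q₁ b q₂ (orderIso-length a q₁ a≅q₁) ⟩
    compat x u a q₁ ∧ compat x u b q₂                  ≡⟨ cong (compat x u a q₁ ∧_)
                                                            (compat-comparesAll d x u b q₂ hx (orderIso-length b q₂ b≅q₂)) ⟩
    compat x u a q₁ ∧ comparesAllᵇ d u q₂              ∎

splitCount : Bool → List ℕ → List ℕ → List ℕ × List ℕ → ℕ
splitCount d X Y (q₁ , q₂) = 𝟙 (crossesᵇ d q₁ q₂) * (copies X q₁ * copies Y q₂)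

copies-++ : ∀ d X Y → All (λ x → All (ComparesAs d x) Y) X → ∀ q →
            copies (X ++ Y) q ≡ ∑ (splits q) (splitCount d X Y)
copies-++ d X Y hXY q = begin
  copies (X ++ Y) q
    ≡⟨ copies-∑ (X ++ Y) q ⟩
  ∑[ s ∈ subseqs (X ++ Y) ] 𝟙 (orderIso s q)
    ≡⟨ ∑-subseqs-++ X Y _ ⟩
  ∑[ a ∈ subseqs X ] ∑[ b ∈ subseqs Y ] 𝟙 (orderIso (a ++ b) q)
    ≡⟨ ∑-cong (subseqs X) (λ a∈ → ∑-cong (subseqs Y) λ b∈ →
         orderIso-++ d _ _ (All.map (λ hx → All-subseqs hx b∈) (All-subseqs hXY a∈)) q) ⟩
  ∑[ a ∈ subseqs X ] ∑[ b ∈ subseqs Y ] ∑ (splits q) (splitTerm d a b)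
    ≡⟨ ∑-cong (subseqs X) (λ {a} _ → ∑-comm (subseqs Y) (splits q) (splitTerm d a)) ⟩
  ∑[ a ∈ subseqs X ] ∑[ s ∈ splits q ] ∑[ b ∈ subseqs Y ] splitTerm d a b s
    ≡⟨ ∑-comm (subseqs X) (splits q) _ ⟩
  ∑[ s ∈ splits q ] ∑[ a ∈ subseqs X ] ∑[ b ∈ subseqs Y ] splitTerm d a b s
    ≡⟨ ∑-cong (splits q) (λ {s} _ → factor s) ⟩
  ∑ (splits q) (splitCount d X Y) ∎
  where
  open ≡-Reasoning
  reorder : ∀ x y r → x * (y * r) ≡ r * (x * y)
  reorder = solve-∀
  factor : ∀ s → ∑[ a ∈ subseqs X ] ∑[ b ∈ subseqs Y ] splitTerm d a b s ≡ splitCount d X Y s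
  factor (q₁ , q₂) = begin
    ∑[ a ∈ subseqs X ] ∑[ b ∈ subseqs Y ] (𝟙 (orderIso a q₁) * (𝟙 (orderIso b q₂) * r))
      ≡⟨ ∑-cong (subseqs X) (λ {a} _ → trans (∑-*ˡ (subseqs Y) (𝟙 (orderIso a q₁)) _)
                                            (cong (𝟙 (orderIso a q₁) *_) (∑-*ʳ (subseqs Y) r _))) ⟩
    ∑[ a ∈ subseqs X ] 𝟙 (orderIso a q₁) * ((∑[ b ∈ subseqs Y ] 𝟙 (orderIso b q₂)) * r)
      ≡⟨ ∑-*ʳ (subseqs X) _ _ ⟩
    (∑[ a ∈ subseqs X ] 𝟙 (orderIso a q₁)) * ((∑[ b ∈ subseqs Y ] 𝟙 (orderIso b q₂)) * r)
      ≡⟨ cong₂ (λ x y → x * (y * r)) (copies-∑ X q₁) (copies-∑ Y q₂) ⟨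
    copies X q₁ * (copies Y q₂ * r)
      ≡⟨ reorder (copies X q₁) (copies Y q₂) r ⟩
    r * (copies X q₁ * copies Y q₂) ∎
    where r = 𝟙 (crossesᵇ d q₁ q₂)

-- On concrete patterns the splitCount terms compute to 0 or to a product of two counts.
copies-++₂ : ∀ d X Y → All (λ x → All (ComparesAs d x) Y) X → ∀ a b →
  copies (X ++ Y) (a ∷ b ∷ []) ≡
  copies Y (a ∷ b ∷ []) + splitCount d X Y (a ∷ [] , b ∷ []) + copies X (a ∷ b ∷ [])
copies-++₂ d X Y hXY a b = begin
  copies (X ++ Y) (a ∷ b ∷ [])
    ≡⟨ copies-++ d X Y hXY _ ⟩
  1 * (copies X [] * copies Y (a ∷ b ∷ [])) + (m + (1 * (copies X (a ∷ b ∷ []) * copies Y []) + 0))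
    ≡⟨ cong₂ (λ x y → 1 * (x * copies Y (a ∷ b ∷ [])) + (m + (1 * (copies X (a ∷ b ∷ []) * y) + 0)))
             (copies-[] X) (copies-[] Y) ⟩
  1 * (1 * copies Y (a ∷ b ∷ [])) + (m + (1 * (copies X (a ∷ b ∷ []) * 1) + 0))
    ≡⟨ simplify (copies Y (a ∷ b ∷ [])) m (copies X (a ∷ b ∷ [])) ⟩
  copies Y (a ∷ b ∷ []) + m + copies X (a ∷ b ∷ []) ∎
  where
  open ≡-Reasoning
  m = splitCount d X Y (a ∷ [] , b ∷ [])
  simplify : ∀ y m x → 1 * (1 * y) + (m + (1 * (x * 1) + 0)) ≡ y + m + x
  simplify = solve-∀

copies-++₃ : ∀ d X Y → All (λ x → All (ComparesAs d x) Y) X → ∀ a b c →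
  copies (X ++ Y) (a ∷ b ∷ c ∷ []) ≡
  copies Y (a ∷ b ∷ c ∷ []) + splitCount d X Y (a ∷ [] , b ∷ c ∷ []) + splitCount d X Y (a ∷ b ∷ [] , c ∷ [])
    + copies X (a ∷ b ∷ c ∷ [])
copies-++₃ d X Y hXY a b c = begin
  copies (X ++ Y) q
    ≡⟨ copies-++ d X Y hXY _ ⟩
  1 * (copies X [] * copies Y q) + (m₁ + (m₂ + (1 * (copies X q * copies Y []) + 0)))
    ≡⟨ cong₂ (λ x y → 1 * (x * copies Y q) + (m₁ + (m₂ + (1 * (copies X q * y) + 0))))
             (copies-[] X) (copies-[] Y) ⟩
  1 * (1 * copies Y q) + (m₁ + (m₂ + (1 * (copies X q * 1) + 0)))
    ≡⟨ simplify (copies Y q) m₁ m₂ (copies X q) ⟩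
  copies Y q + m₁ + m₂ + copies X q ∎
  where
  open ≡-Reasoning
  q = a ∷ b ∷ c ∷ []
  m₁ = splitCount d X Y (a ∷ [] , b ∷ c ∷ [])
  m₂ = splitCount d X Y (a ∷ b ∷ [] , c ∷ [])
  simplify : ∀ y m₁ m₂ x → 1 * (1 * y) + (m₁ + (m₂ + (1 * (x * 1) + 0))) ≡ y + m₁ + m₂ + x
  simplify = solve-∀

-- Pattern counts in a glued word

p12 p21 : List ℕ
p12 = 1 ∷ 2 ∷ []
p21 = 2 ∷ 1 ∷ []

<⇒<ᵇ≡true : ∀ {m n} → m < n → (m <ᵇ n) ≡ true
<⇒<ᵇ≡true {zero}  {suc n} _         = refl
<⇒<ᵇ≡true {suc m} {suc n} (s≤s m<n) = <⇒<ᵇ≡true m<n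

≤⇒<ᵇ≡false : ∀ {m n} → n ≤ m → (m <ᵇ n) ≡ false
≤⇒<ᵇ≡false {m}     {zero}  _         = refl
≤⇒<ᵇ≡false {suc m} {suc n} (s≤s n≤m) = ≤⇒<ᵇ≡false n≤m

<⇒comparesAs-true : ∀ {x y} → x < y → ComparesAs true x y
<⇒comparesAs-true x<y = <⇒<ᵇ≡true x<y , ≤⇒<ᵇ≡false (<⇒≤ x<y)

>⇒comparesAs-false : ∀ {x y} → y < x → ComparesAs false x y
>⇒comparesAs-false y<x = ≤⇒<ᵇ≡false (<⇒≤ y<x) , <⇒<ᵇ≡true y<x

below-max : ∀ {W m} → All (_< m) W → All (λ w → All (ComparesAs true w) (m ∷ [])) W
below-max = All.map (λ w<m → <⇒comparesAs-true w<m ∷ [])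

-- A new maximum can only play the last entry of q.
copies-∷ʳ-max₂ : ∀ W m → All (_< m) W → ∀ a b →
  copies (W ++ m ∷ []) (a ∷ b ∷ []) ≡ copies W (a ∷ b ∷ []) + 𝟙 (crossesᵇ true (a ∷ []) (b ∷ [])) * length W
copies-∷ʳ-max₂ W m W<m a b = begin
  copies (W ++ m ∷ []) (a ∷ b ∷ [])
    ≡⟨ copies-++₂ true W (m ∷ []) (below-max W<m) a b ⟩
  0 + 𝟙 (crossesᵇ true (a ∷ []) (b ∷ [])) * (copies W (a ∷ []) * 1) + copies W (a ∷ b ∷ [])
    ≡⟨ cong (λ x → 0 + 𝟙 (crossesᵇ true (a ∷ []) (b ∷ [])) * (x * 1) + copies W (a ∷ b ∷ [])) (copies-[-] W a) ⟩
  0 + 𝟙 (crossesᵇ true (a ∷ []) (b ∷ [])) * (length W * 1) + copies W (a ∷ b ∷ [])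
    ≡⟨ simplify (𝟙 (crossesᵇ true (a ∷ []) (b ∷ []))) (length W) _ ⟩
  copies W (a ∷ b ∷ []) + 𝟙 (crossesᵇ true (a ∷ []) (b ∷ [])) * length W ∎
  where
  open ≡-Reasoning
  simplify : ∀ c l x → 0 + c * (l * 1) + x ≡ x + c * l
  simplify = solve-∀

copies-∷ʳ-max₃ : ∀ W m → All (_< m) W → ∀ a b c →
  copies (W ++ m ∷ []) (a ∷ b ∷ c ∷ []) ≡
  copies W (a ∷ b ∷ c ∷ []) + 𝟙 (crossesᵇ true (a ∷ b ∷ []) (c ∷ [])) * copies W (a ∷ b ∷ [])
copies-∷ʳ-max₃ W m W<m a b c = begin
  copies (W ++ m ∷ []) (a ∷ b ∷ c ∷ [])
    ≡⟨ copies-++₃ true W (m ∷ []) (below-max W<m) a b c ⟩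
  0 + cr₁ * (copies W (a ∷ []) * 0) + cr₂ * (copies W (a ∷ b ∷ []) * 1) + copies W (a ∷ b ∷ c ∷ [])
    ≡⟨ simplify cr₁ (copies W (a ∷ [])) cr₂ _ _ ⟩
  copies W (a ∷ b ∷ c ∷ []) + cr₂ * copies W (a ∷ b ∷ []) ∎
  where
  open ≡-Reasoning
  cr₁ = 𝟙 (crossesᵇ true (a ∷ []) (b ∷ c ∷ []))
  cr₂ = 𝟙 (crossesᵇ true (a ∷ b ∷ []) (c ∷ []))
  simplify : ∀ c₁ y c₂ z x → 0 + c₁ * (y * 0) + c₂ * (z * 1) + x ≡ x + c₂ * z
  simplify = solve-∀

copies-23≡copies-12 : ∀ p → copies p (2 ∷ 3 ∷ []) ≡ copies p p12
copies-23≡copies-12 p = trans (copies-∑ p _) (trans (∑-cong (subseqs p) λ {s} _ → cong 𝟙 (same s)) (sym (copies-∑ p p12)))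
  where
  same : ∀ s → orderIso s (2 ∷ 3 ∷ []) ≡ orderIso s p12
  same []              = refl
  same (_ ∷ [])        = refl
  same (_ ∷ _ ∷ [])    = refl
  same (_ ∷ _ ∷ _ ∷ _) = refl

Within : ℕ → List ℕ → Set
Within n = All (λ x → 1 ≤ x × x ≤ n)

glue : ℕ → ℕ → List ℕ → List ℕ → List ℕ
glue i j L R = map (j +_) L ++ suc (i + j) ∷ R

module GlueCounts {i j : ℕ} {L R : List ℕ} (L-within : Within i L) (R-within : Within j R) where

  private
    L↑ X : List ℕ
    L↑ = map (j +_) L
    X  = L↑ ++ suc (i + j) ∷ []

    glue≡X++R : glue i j L R ≡ X ++ R
    glue≡X++R = sym (++-assoc L↑ (suc (i + j) ∷ []) R)

    L↑<max : All (_< suc (i + j)) L↑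
    L↑<max = All.map⁺ (All.map (λ {l} (_ , l≤i) → s≤s (≤-trans (+-monoʳ-≤ j l≤i) (≤-reflexive (+-comm j i)))) L-within)

    X-above-R : All (λ x → All (ComparesAs false x) R) X
    X-above-R = All.++⁺ (All.map⁺ (All.map (λ {l} (1≤l , _) → above (λ y≤j → ≤-trans (s≤s y≤j) (j<j+l 1≤l))) L-within))
                        (above (λ y≤j → s≤s (≤-trans y≤j (m≤n+m j i))) ∷ [])
      where
      j<j+l : ∀ {l} → 1 ≤ l → j < j + l
      j<j+l {l} 1≤l = subst (_≤ j + l) (+-comm j 1) (+-monoʳ-≤ j 1≤l)
      above : ∀ {x} → (∀ {y} → y ≤ j → y < x) → All (ComparesAs false x) R
      above y<x = All.map (λ (_ , y≤j) → >⇒comparesAs-false (y<x y≤j)) R-within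

    copies-L↑ : ∀ q → copies L↑ q ≡ copies L q
    copies-L↑ = copies-translate j L

    length-X : length X ≡ suc (length L)
    length-X = trans (length-++ L↑) (trans (+-comm (length L↑) 1) (cong suc (length-map (j +_) L)))

    copies-X-12 : copies X p12 ≡ copies L p12 + length L
    copies-X-12 = begin
      copies X p12                              ≡⟨ copies-∷ʳ-max₂ L↑ _ L↑<max 1 2 ⟩
      copies L↑ p12 + (length L↑ + 0)           ≡⟨ cong₂ (λ x y → x + (y + 0)) (copies-L↑ p12) (length-map (j +_) L) ⟩
      copies L p12 + (length L + 0)             ≡⟨ cong (copies L p12 +_) (+-identityʳ (length L)) ⟩
      copies L p12 + length L                   ∎
      where open ≡-Reasoning

  copies-glue-12 : copies (glue i j L R) p12 ≡ copies L p12 + copies R p12 + length L * 1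
  copies-glue-12 rewrite glue≡X++R = begin
    copies (X ++ R) p12                             ≡⟨ copies-++₂ false X R X-above-R 1 2 ⟩
    copies R p12 + 0 + copies X p12                 ≡⟨ cong (copies R p12 + 0 +_) copies-X-12 ⟩
    copies R p12 + 0 + (copies L p12 + length L)    ≡⟨ simplify (copies R p12) (copies L p12) (length L) ⟩
    copies L p12 + copies R p12 + length L * 1      ∎
    where
    open ≡-Reasoning
    simplify : ∀ r x l → r + 0 + (x + l) ≡ x + r + l * 1
    simplify = solve-∀

  copies-glue-21 : copies (glue i j L R) p21 ≡ copies L p21 + copies R p21 + suc (length L) * length R
  copies-glue-21 rewrite glue≡X++R = begin
    copies (X ++ R) p21
      ≡⟨ copies-++₂ false X R X-above-R 2 1 ⟩
    copies R p21 + (copies X (2 ∷ []) * copies R (1 ∷ []) + 0) + copies X p21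
      ≡⟨ cong₂ (λ x y → copies R p21 + (x * y + 0) + copies X p21) (copies-[-] X 2) (copies-[-] R 1) ⟩
    copies R p21 + (length X * length R + 0) + copies X p21
      ≡⟨ cong₂ (λ x y → copies R p21 + (x * length R + 0) + y) length-X (copies-∷ʳ-max₂ L↑ _ L↑<max 2 1) ⟩
    copies R p21 + (suc (length L) * length R + 0) + (copies L↑ p21 + 0)
      ≡⟨ cong (λ x → copies R p21 + (suc (length L) * length R + 0) + (x + 0)) (copies-L↑ p21) ⟩
    copies R p21 + (suc (length L) * length R + 0) + (copies L p21 + 0)
      ≡⟨ simplify (copies R p21) (suc (length L) * length R) (copies L p21) ⟩
    copies L p21 + copies R p21 + suc (length L) * length R ∎
    where
    open ≡-Reasoning
    simplify : ∀ r m x → r + (m + 0) + (x + 0) ≡ x + r + m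
    simplify = solve-∀

  copies-glue-132 : copies (glue i j L R) p132 ≡ copies L p132 + copies R p132
  copies-glue-132 rewrite glue≡X++R = begin
    copies (X ++ R) p132
      ≡⟨ copies-++₃ false X R X-above-R 1 3 2 ⟩
    copies R p132 + 0 + 0 + copies X p132
      ≡⟨ cong (copies R p132 + 0 + 0 +_) (copies-∷ʳ-max₃ L↑ _ L↑<max 1 3 2) ⟩
    copies R p132 + 0 + 0 + (copies L↑ p132 + 0)
      ≡⟨ cong (λ x → copies R p132 + 0 + 0 + (x + 0)) (copies-L↑ p132) ⟩
    copies R p132 + 0 + 0 + (copies L p132 + 0)
      ≡⟨ simplify (copies R p132) (copies L p132) ⟩
    copies L p132 + copies R p132 ∎
    where
    open ≡-Reasoning
    simplify : ∀ r x → r + 0 + 0 + (x + 0) ≡ x + r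
    simplify = solve-∀

  copies-glue-213 : copies (glue i j L R) p213 ≡ copies L p213 + copies R p213 + copies L p21 * 1
  copies-glue-213 rewrite glue≡X++R = begin
    copies (X ++ R) p213
      ≡⟨ copies-++₃ false X R X-above-R 2 1 3 ⟩
    copies R p213 + 0 + 0 + copies X p213
      ≡⟨ cong (copies R p213 + 0 + 0 +_) (copies-∷ʳ-max₃ L↑ _ L↑<max 2 1 3) ⟩
    copies R p213 + 0 + 0 + (copies L↑ p213 + (copies L↑ p21 + 0))
      ≡⟨ cong₂ (λ x y → copies R p213 + 0 + 0 + (x + (y + 0))) (copies-L↑ p213) (copies-L↑ p21) ⟩
    copies R p213 + 0 + 0 + (copies L p213 + (copies L p21 + 0))
      ≡⟨ simplify (copies R p213) (copies L p213) (copies L p21) ⟩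
    copies L p213 + copies R p213 + copies L p21 * 1 ∎
    where
    open ≡-Reasoning
    simplify : ∀ r x y → r + 0 + 0 + (x + (y + 0)) ≡ x + r + y * 1
    simplify = solve-∀

  copies-glue-312 : copies (glue i j L R) p312 ≡ copies L p312 + copies R p312 + suc (length L) * copies R p12
  copies-glue-312 rewrite glue≡X++R = begin
    copies (X ++ R) p312
      ≡⟨ copies-++₃ false X R X-above-R 3 1 2 ⟩
    copies R p312 + (copies X (3 ∷ []) * copies R p12 + 0) + 0 + copies X p312
      ≡⟨ cong₂ (λ x y → copies R p312 + (x * copies R p12 + 0) + 0 + y)
               (trans (copies-[-] X 3) length-X) (copies-∷ʳ-max₃ L↑ _ L↑<max 3 1 2) ⟩
    copies R p312 + (suc (length L) * copies R p12 + 0) + 0 + (copies L↑ p312 + 0)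
      ≡⟨ cong (λ x → copies R p312 + (suc (length L) * copies R p12 + 0) + 0 + (x + 0)) (copies-L↑ p312) ⟩
    copies R p312 + (suc (length L) * copies R p12 + 0) + 0 + (copies L p312 + 0)
      ≡⟨ simplify (copies R p312) (suc (length L) * copies R p12) (copies L p312) ⟩
    copies L p312 + copies R p312 + suc (length L) * copies R p12 ∎
    where
    open ≡-Reasoning
    simplify : ∀ r m x → r + (m + 0) + 0 + (x + 0) ≡ x + r + m
    simplify = solve-∀

  copies-glue-231 : copies (glue i j L R) p231 ≡ copies L p231 + copies R p231 + (copies L p12 + length L) * length R
  copies-glue-231 rewrite glue≡X++R = begin
    copies (X ++ R) p231
      ≡⟨ copies-++₃ false X R X-above-R 2 3 1 ⟩
    copies R p231 + 0 + (copies X (2 ∷ 3 ∷ []) * copies R (1 ∷ []) + 0) + copies X p231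
      ≡⟨ cong₂ (λ x y → copies R p231 + 0 + (x * y + 0) + copies X p231)
               (trans (copies-23≡copies-12 X) copies-X-12) (copies-[-] R 1) ⟩
    copies R p231 + 0 + ((copies L p12 + length L) * length R + 0) + copies X p231
      ≡⟨ cong (copies R p231 + 0 + ((copies L p12 + length L) * length R + 0) +_)
              (trans (copies-∷ʳ-max₃ L↑ _ L↑<max 2 3 1) (cong (_+ 0) (copies-L↑ p231))) ⟩
    copies R p231 + 0 + ((copies L p12 + length L) * length R + 0) + (copies L p231 + 0)
      ≡⟨ simplify (copies R p231) ((copies L p12 + length L) * length R) (copies L p231) ⟩
    copies L p231 + copies R p231 + (copies L p12 + length L) * length R ∎
    where
    open ≡-Reasoning
    simplify : ∀ r m x → r + 0 + (m + 0) + (x + 0) ≡ x + r + m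
    simplify = solve-∀

-- Permutations of 1‥n

range : ℕ → List ℕ
range zero    = []
range (suc n) = range n ++ suc n ∷ []

∈-range⁻ : ∀ n {x} → x ∈ range n → 1 ≤ x × x ≤ n
∈-range⁻ (suc n) x∈ with ∈-++⁻ (range n) x∈
... | inj₁ x∈′          = let 1≤x , x≤n = ∈-range⁻ n x∈′ in 1≤x , m≤n⇒m≤1+n x≤n
... | inj₂ (here refl) = s≤s z≤n , ≤-refl

length-range : ∀ n → length (range n) ≡ n
length-range zero    = refl
length-range (suc n) = trans (length-++ (range n)) (trans (+-comm (length (range n)) 1) (cong suc (length-range n)))

range-unique : ∀ n → Unique (range n)
range-unique zero    = []
range-unique (suc n) =
  Unique.++⁺ (range-unique n) ([] ∷ []) λ { (x∈ , here x≡) → <-irrefl x≡ (s≤s (proj₂ (∈-range⁻ n x∈))) }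

range-+ : ∀ t k → range (t + k) ≡ range t ++ map (t +_) (range k)
range-+ t zero    rewrite +-identityʳ t = sym (++-identityʳ (range t))
range-+ t (suc k) rewrite +-suc t k | range-+ t k = begin
  (range t ++ map (t +_) (range k)) ++ suc (t + k) ∷ []    ≡⟨ ++-assoc (range t) _ _ ⟩
  range t ++ (map (t +_) (range k) ++ suc (t + k) ∷ [])    ≡⟨ cong (λ x → range t ++ (map (t +_) (range k) ++ x ∷ [])) (+-suc t k) ⟨
  range t ++ (map (t +_) (range k) ++ t + suc k ∷ [])      ≡⟨ cong (range t ++_) (map-++ (t +_) (range k) _) ⟨
  range t ++ map (t +_) (range (suc k))                    ∎
  where open ≡-Reasoning

Unique-resp-↭ : ∀ {xs ys : List ℕ} → xs ↭ ys → Unique xs → Unique ys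
Unique-resp-↭ xs↭ys = Permutationₛ.Unique-resp-↭ (setoid ℕ) (↭⇒↭ₛ xs↭ys)

concatMap-unique : ∀ {A B : Set} (f : A → List B) {xs} → Unique xs → (∀ {x} → x ∈ xs → Unique (f x)) →
  (∀ {x x′ y} → x ∈ xs → x′ ∈ xs → y ∈ f x → y ∈ f x′ → x ≡ x′) → Unique (concatMap f xs)
concatMap-unique f {[]}     _            _        _        = []
concatMap-unique f {x ∷ xs} (x∉xs ∷ uxs) unique-f disjoint =
  Unique.++⁺ (unique-f (here refl))
             (concatMap-unique f uxs (unique-f ∘ there) λ x∈ x′∈ → disjoint (there x∈) (there x′∈))
             λ { (y∈fx , y∈rest) → let x′ , x′∈ , y∈fx′ = find (∈-concatMap⁻ f y∈rest) in
                 All.lookup x∉xs x′∈ (disjoint (here refl) (there x′∈) y∈fx y∈fx′) }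

∈-insertAll⁻ : ∀ x q {p} → p ∈ insertAll x q → ∃₂ λ A B → q ≡ A ++ B × p ≡ A ++ x ∷ B
∈-insertAll⁻ x []       (here refl) = [] , [] , refl , refl
∈-insertAll⁻ x (y ∷ ys) (here refl) = [] , y ∷ ys , refl , refl
∈-insertAll⁻ x (y ∷ ys) (there p∈) with ∈-map⁻ (y ∷_) p∈
... | p′ , p′∈ , refl with ∈-insertAll⁻ x ys p′∈
...   | A , B , refl , refl = y ∷ A , B , refl , refl

∈-insertAll⁺ : ∀ x A B → A ++ x ∷ B ∈ insertAll x (A ++ B)
∈-insertAll⁺ x []      []      = here refl
∈-insertAll⁺ x []      (y ∷ B) = here refl
∈-insertAll⁺ x (a ∷ A) B       = there (∈-map⁺ (a ∷_) (∈-insertAll⁺ x A B))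

insertAll-unique : ∀ x q → x ∉ q → Unique (insertAll x q)
insertAll-unique x []       _   = [] ∷ []
insertAll-unique x (y ∷ ys) x∉ =
  All.tabulate headDiffers ∷ Unique.map⁺ ∷-injectiveʳ (insertAll-unique x ys (x∉ ∘ there))
  where
  headDiffers : ∀ {z} → z ∈ map (y ∷_) (insertAll x ys) → ¬ (x ∷ y ∷ ys ≡ z)
  headDiffers z∈ e with ∈-map⁻ (y ∷_) z∈
  ... | _ , _ , refl = x∉ (here (proj₁ (∷-injective e)))

++-∷-injective : ∀ (x : ℕ) A B A′ B′ → x ∉ A → x ∉ A′ → A ++ x ∷ B ≡ A′ ++ x ∷ B′ → A ≡ A′ × B ≡ B′
++-∷-injective x []      B []        B′ _   _    e = refl , ∷-injectiveʳ e
++-∷-injective x []      B (a ∷ A′) B′ _   x∉A′ e = ⊥-elim (x∉A′ (here (proj₁ (∷-injective e))))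
++-∷-injective x (a ∷ A) B []        B′ x∉A _    e = ⊥-elim (x∉A (here (sym (proj₁ (∷-injective e)))))
++-∷-injective x (a ∷ A) B (a′ ∷ A′) B′ x∉A x∉A′ e with ∷-injective e
... | refl , e′ with ++-∷-injective x A B A′ B′ (λ x∈ → x∉A (there x∈)) (λ x∈ → x∉A′ (there x∈)) e′
...   | refl , refl = refl , refl

insertAll-disjoint : ∀ x q q′ {p} → x ∉ q → x ∉ q′ → p ∈ insertAll x q → p ∈ insertAll x q′ → q ≡ q′
insertAll-disjoint x q q′ x∉q x∉q′ p∈ p∈′ with ∈-insertAll⁻ x q p∈ | ∈-insertAll⁻ x q′ p∈′
... | A , B , refl , refl | A′ , B′ , refl , e =
  let A≡A′ , B≡B′ = ++-∷-injective x A B A′ B′ (λ x∈ → x∉q (∈-++⁺ˡ x∈)) (λ x∈ → x∉q′ (∈-++⁺ˡ x∈)) e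
  in cong₂ _++_ A≡A′ B≡B′

removeMax : ∀ n {p} → p ↭ range (suc n) → ∃₂ λ A B → p ≡ A ++ suc n ∷ B × A ++ B ↭ range n
removeMax n p↭ with ∈-∃++ (∈-resp-↭ (↭-sym p↭) (∈-++⁺ʳ (range n) (here refl)))
... | A , B , refl = A , B , refl ,
  drop-∷ (↭-trans (↭-sym (shift (suc n) A B)) (↭-trans p↭ (++-comm (range n) (suc n ∷ []))))

∈-perms⁻ : ∀ n {p} → p ∈ perms n → p ↭ range n
∈-perms⁻ zero    (here refl) = ↭-refl
∈-perms⁻ (suc n) p∈ with find (∈-concatMap⁻ (insertAll (suc n)) p∈)
... | q , q∈ , p∈′ with ∈-insertAll⁻ (suc n) q p∈′
...   | A , B , refl , refl =
  ↭-trans (shift (suc n) A B) (↭-trans (prep (suc n) (∈-perms⁻ n q∈)) (++-comm (suc n ∷ []) (range n)))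

∈-perms⁺ : ∀ n {p} → p ↭ range n → p ∈ perms n
∈-perms⁺ zero    p↭ rewrite ↭-empty-inv p↭ = here refl
∈-perms⁺ (suc n) p↭ with removeMax n p↭
... | A , B , refl , A++B↭ = ∈-concatMap⁺ (insertAll (suc n)) (lose (∈-perms⁺ n A++B↭) (∈-insertAll⁺ (suc n) A B))

perms-unique : ∀ n → Unique (perms n)
perms-unique zero    = [] ∷ []
perms-unique (suc n) = concatMap-unique (insertAll (suc n)) (perms-unique n)
  (λ q∈ → insertAll-unique (suc n) _ (max∉ q∈))
  (λ q∈ q′∈ → insertAll-disjoint (suc n) _ _ (max∉ q∈) (max∉ q′∈))
  where
  max∉ : ∀ {q} → q ∈ perms n → suc n ∉ q
  max∉ q∈ x∈ = <-irrefl refl (proj₂ (∈-range⁻ n (∈-resp-↭ (∈-perms⁻ n q∈) x∈)))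

-- The 132-avoiders of length n + 1 are exactly the glued words

Avoiders : ℕ → List (List ℕ)
Avoiders n = filter (λ p → avoidsᵇ p p132 ≟ true) (perms n)

avoidsᵇ≡true⇒ : ∀ p r → avoidsᵇ p r ≡ true → copies p r ≡ 0
avoidsᵇ≡true⇒ p r e with copies p r
... | zero = refl

⇒avoidsᵇ≡true : ∀ p r → copies p r ≡ 0 → avoidsᵇ p r ≡ true
⇒avoidsᵇ≡true p r e with copies p r
... | zero = refl

∈-Avoiders⁻ : ∀ n {p} → p ∈ Avoiders n → p ↭ range n × copies p p132 ≡ 0
∈-Avoiders⁻ n {p} p∈ = let p∈perms , avoids = ∈-filter⁻ (λ p → avoidsᵇ p p132 ≟ true) {xs = perms n} p∈
                       in ∈-perms⁻ n p∈perms , avoidsᵇ≡true⇒ p p132 avoids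

∈-Avoiders⁺ : ∀ n {p} → p ↭ range n → copies p p132 ≡ 0 → p ∈ Avoiders n
∈-Avoiders⁺ n {p} p↭ avoids = ∈-filter⁺ (λ p → avoidsᵇ p p132 ≟ true) (∈-perms⁺ n p↭) (⇒avoidsᵇ≡true p p132 avoids)

Avoiders-unique : ∀ n → Unique (Avoiders n)
Avoiders-unique n = Unique.filter⁺ (λ p → avoidsᵇ p p132 ≟ true) (perms-unique n)

↭-range⇒Within : ∀ n {p} → p ↭ range n → Within n p
↭-range⇒Within n p↭ = All.tabulate (∈-range⁻ n ∘ ∈-resp-↭ p↭)

∈-Avoiders⇒Within : ∀ n {p} → p ∈ Avoiders n → Within n p
∈-Avoiders⇒Within n = ↭-range⇒Within n ∘ proj₁ ∘ ∈-Avoiders⁻ n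

∈-Avoiders⇒length : ∀ n {p} → p ∈ Avoiders n → length p ≡ n
∈-Avoiders⇒length n p∈ = trans (↭-length (proj₁ (∈-Avoiders⁻ n p∈))) (length-range n)

sucˡ : ℕ × ℕ → ℕ × ℕ
sucˡ (i , j) = suc i , j

antidiagonalPairs : ℕ → List (ℕ × ℕ)
antidiagonalPairs zero    = (0 , 0) ∷ []
antidiagonalPairs (suc n) = (0 , suc n) ∷ map sucˡ (antidiagonalPairs n)

∈-antidiagonalPairs⁻ : ∀ n {i j} → (i , j) ∈ antidiagonalPairs n → i + j ≡ n
∈-antidiagonalPairs⁻ zero    (here refl) = refl
∈-antidiagonalPairs⁻ (suc n) (here refl) = refl
∈-antidiagonalPairs⁻ (suc n) (there ij∈) with ∈-map⁻ sucˡ ij∈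
... | _ , ij′∈ , refl = cong suc (∈-antidiagonalPairs⁻ n ij′∈)

∈-antidiagonalPairs⁺ : ∀ n i j → i + j ≡ n → (i , j) ∈ antidiagonalPairs n
∈-antidiagonalPairs⁺ zero    zero    zero      refl = here refl
∈-antidiagonalPairs⁺ (suc n) zero    .(suc n) refl = here refl
∈-antidiagonalPairs⁺ (suc n) (suc i) j         e    = there (∈-map⁺ sucˡ (∈-antidiagonalPairs⁺ n i j (suc-injective e)))

antidiagonalPairs-unique : ∀ n → Unique (antidiagonalPairs n)
antidiagonalPairs-unique zero    = [] ∷ []
antidiagonalPairs-unique (suc n) =
  All.tabulate headDiffers ∷ Unique.map⁺ sucˡ-injective (antidiagonalPairs-unique n)
  where
  headDiffers : ∀ {ij} → ij ∈ map sucˡ (antidiagonalPairs n) → ¬ ((0 , suc n) ≡ ij)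
  headDiffers ij∈ e with ∈-map⁻ sucˡ ij∈
  headDiffers ij∈ () | _ , _ , refl
  sucˡ-injective : ∀ {ij ij′} → sucˡ ij ≡ sucˡ ij′ → ij ≡ ij′
  sucˡ-injective {_ , _} {_ , _} refl = refl

∑-antidiagonalPairs : ∀ G n → ∑[ ij ∈ antidiagonalPairs n ] G (proj₁ ij) (proj₂ ij) ≡ antidiagonal G n
∑-antidiagonalPairs G zero    = +-identityʳ (G 0 0)
∑-antidiagonalPairs G (suc n) = cong (G 0 (suc n) +_)
  (trans (∑-map sucˡ (antidiagonalPairs n) _) (∑-antidiagonalPairs (λ i j → G (suc i) j) n))

gluingsAt : ℕ × ℕ → List (List ℕ)
gluingsAt (i , j) = concatMap (λ L → map (glue i j L) (Avoiders j)) (Avoiders i)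

gluings : ℕ → List (List ℕ)
gluings n = concatMap gluingsAt (antidiagonalPairs n)

∈-gluingsAt⁻ : ∀ {i j p} → p ∈ gluingsAt (i , j) → ∃₂ λ L R → L ∈ Avoiders i × R ∈ Avoiders j × p ≡ glue i j L R
∈-gluingsAt⁻ {i} {j} p∈ with find (∈-concatMap⁻ (λ L → map (glue i j L) (Avoiders j)) p∈)
... | L , L∈ , p∈′ with ∈-map⁻ (glue i j L) p∈′
...   | R , R∈ , refl = L , R , L∈ , R∈ , refl

∈-gluings⁻ : ∀ n {p} → p ∈ gluings n → ∃₂ λ i j → ∃₂ λ L R →
  i + j ≡ n × L ∈ Avoiders i × R ∈ Avoiders j × p ≡ glue i j L R
∈-gluings⁻ n p∈ with find (∈-concatMap⁻ gluingsAt p∈)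
... | (i , j) , ij∈ , p∈′ with ∈-gluingsAt⁻ {i} {j} p∈′
...   | L , R , L∈ , R∈ , refl = i , j , L , R , ∈-antidiagonalPairs⁻ n ij∈ , L∈ , R∈ , refl

∈-gluings⁺ : ∀ n {i j L R} → i + j ≡ n → L ∈ Avoiders i → R ∈ Avoiders j → glue i j L R ∈ gluings n
∈-gluings⁺ n {i} {j} i+j≡n L∈ R∈ = ∈-concatMap⁺ gluingsAt (lose (∈-antidiagonalPairs⁺ n i j i+j≡n)
  (∈-concatMap⁺ (λ L → map (glue i j L) (Avoiders j)) (lose L∈ (∈-map⁺ (glue i j _) R∈))))

max∉shifted : ∀ i j {L} → Within i L → suc (i + j) ∉ map (j +_) L
max∉shifted i j L-within x∈ with ∈-map⁻ (j +_) x∈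
... | l , l∈ , e =
  <-irrefl (sym e) (s≤s (≤-trans (+-monoʳ-≤ j (proj₂ (All.lookup L-within l∈))) (≤-reflexive (+-comm j i))))

-- The size of the left block is read off its length, which fixes the shift.
glue-injective : ∀ {i j i′ j′ L R L′ R′} → i + j ≡ i′ + j′ →
  Within i L → Within i′ L′ → length L ≡ i → length L′ ≡ i′ →
  glue i j L R ≡ glue i′ j′ L′ R′ → i ≡ i′ × j ≡ j′ × L ≡ L′ × R ≡ R′
glue-injective {i} {j} {i′} {j′} {L} {R} {L′} {R′} i+j≡ hL hL′ |L| |L′| e
  with ++-∷-injective (suc (i + j)) (map (j +_) L) R (map (j′ +_) L′) R′ (max∉shifted i j hL)
         (subst (λ x → suc x ∉ map (j′ +_) L′) (sym i+j≡) (max∉shifted i′ j′ hL′))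
         (subst (λ x → glue i j L R ≡ map (j′ +_) L′ ++ suc x ∷ R′) (sym i+j≡) e)
... | L↑≡ , R≡ = i≡ , j≡ , L≡ , R≡
  where
  i≡ : i ≡ i′
  i≡ = begin
    i                        ≡⟨ |L| ⟨
    length L                 ≡⟨ length-map (j +_) L ⟨
    length (map (j +_) L)    ≡⟨ cong length L↑≡ ⟩
    length (map (j′ +_) L′)  ≡⟨ length-map (j′ +_) L′ ⟩
    length L′                ≡⟨ |L′| ⟩
    i′                       ∎
    where open ≡-Reasoning
  j≡ : j ≡ j′
  j≡ = +-cancelˡ-≡ i j j′ (trans i+j≡ (cong (_+ j′) (sym i≡)))
  L≡ : L ≡ L′
  L≡ = map-injective (+-cancelˡ-≡ j _ _) (trans L↑≡ (cong (λ x → map (x +_) L′) (sym j≡)))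

glue-injective-Avoiders : ∀ {i j i′ j′ L R L′ R′} → i + j ≡ i′ + j′ → L ∈ Avoiders i → L′ ∈ Avoiders i′ →
  glue i j L R ≡ glue i′ j′ L′ R′ → i ≡ i′ × j ≡ j′ × L ≡ L′ × R ≡ R′
glue-injective-Avoiders {i} {i′ = i′} i+j≡ L∈ L′∈ =
  glue-injective i+j≡ (∈-Avoiders⇒Within i L∈) (∈-Avoiders⇒Within i′ L′∈) (∈-Avoiders⇒length i L∈) (∈-Avoiders⇒length i′ L′∈)

gluings-unique : ∀ n → Unique (gluings n)
gluings-unique n = concatMap-unique gluingsAt (antidiagonalPairs-unique n) gluingsAt-unique pairs-disjoint
  where
  gluingsAt-unique : ∀ {ij} → ij ∈ antidiagonalPairs n → Unique (gluingsAt ij)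
  gluingsAt-unique {i , j} _ = concatMap-unique _ (Avoiders-unique i)
    (λ {L} _ → Unique.map⁺ (λ {R} {R′} e → ∷-injectiveʳ (++-cancelˡ (map (j +_) L) (_ ∷ R) (_ ∷ R′) e)) (Avoiders-unique j))
    sameLeft
    where
    sameLeft : ∀ {L L′ p} → L ∈ Avoiders i → L′ ∈ Avoiders i →
               p ∈ map (glue i j L) (Avoiders j) → p ∈ map (glue i j L′) (Avoiders j) → L ≡ L′
    sameLeft L∈ L′∈ p∈ p′∈ with ∈-map⁻ _ p∈ | ∈-map⁻ _ p′∈
    ... | _ , _ , refl | _ , _ , e = proj₁ (proj₂ (proj₂ (glue-injective-Avoiders refl L∈ L′∈ e)))
  pairs-disjoint : ∀ {ij ij′ p} → ij ∈ antidiagonalPairs n → ij′ ∈ antidiagonalPairs n →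
                   p ∈ gluingsAt ij → p ∈ gluingsAt ij′ → ij ≡ ij′
  pairs-disjoint {i , j} {i′ , j′} ij∈ ij′∈ p∈ p′∈ with ∈-gluingsAt⁻ {i} {j} p∈ | ∈-gluingsAt⁻ {i′} {j′} p′∈
  ... | _ , _ , L∈ , _ , refl | _ , _ , L′∈ , _ , e
    with glue-injective-Avoiders (trans (∈-antidiagonalPairs⁻ n ij∈) (sym (∈-antidiagonalPairs⁻ n ij′∈))) L∈ L′∈ e
  ...   | refl , refl , _ = refl

glue-↭ : ∀ {i j L R} → L ↭ range i → R ↭ range j → glue i j L R ↭ range (suc (i + j))
glue-↭ {i} {j} {L} {R} L↭ R↭ = begin
  map (j +_) L ++ m ∷ R                 ↭⟨ ++⁺ (map⁺ (j +_) L↭) (prep m R↭) ⟩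
  map (j +_) (range i) ++ m ∷ range j   ↭⟨ ++-comm (map (j +_) (range i)) (m ∷ range j) ⟩
  m ∷ (range j ++ map (j +_) (range i)) ↭⟨ ++-comm (m ∷ []) (range j ++ map (j +_) (range i)) ⟩
  (range j ++ map (j +_) (range i)) ++ m ∷ [] ≡⟨ cong (_++ m ∷ []) (trans (sym (range-+ j i)) (cong range (+-comm j i))) ⟩
  range (i + j) ++ m ∷ []               ∎
  where
  open PermutationReasoning
  m = suc (i + j)

gluings⊆Avoiders : ∀ n {p} → p ∈ gluings n → p ∈ Avoiders (suc n)
gluings⊆Avoiders n p∈ with ∈-gluings⁻ n p∈
... | i , j , L , R , refl , L∈ , R∈ , refl =
  let L↭ , L-avoids = ∈-Avoiders⁻ i L∈
      R↭ , R-avoids = ∈-Avoiders⁻ j R∈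
  in ∈-Avoiders⁺ (suc (i + j)) (glue-↭ L↭ R↭)
       (trans (GlueCounts.copies-glue-132 (↭-range⇒Within i L↭) (↭-range⇒Within j R↭))
              (cong₂ _+_ L-avoids R-avoids))

copies-≢0 : ∀ p q {s} → s ∈ subseqs p → orderIso s q ≡ true → copies p q ≢ 0
copies-≢0 p q s∈ s≅q copies≡0 =
  <-irrefl (sym copies≡0) (filter-some (λ s → orderIso s q ≟ true) (lose s∈ s≅q))

[]∈subseqs : ∀ xs → [] ∈ subseqs xs
[]∈subseqs []       = here refl
[]∈subseqs (x ∷ xs) = ∈-++⁺ʳ (map (x ∷_) (subseqs xs)) ([]∈subseqs xs)

∈-subseqs-++ʳ : ∀ A {Y s} → s ∈ subseqs Y → s ∈ subseqs (A ++ Y)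
∈-subseqs-++ʳ []      s∈ = s∈
∈-subseqs-++ʳ (x ∷ A) s∈ = ∈-++⁺ʳ (map (x ∷_) (subseqs (A ++ _))) (∈-subseqs-++ʳ A s∈)

∷-∈-subseqs-++ : ∀ A {Y a s} → a ∈ A → s ∈ subseqs Y → a ∷ s ∈ subseqs (A ++ Y)
∷-∈-subseqs-++ (x ∷ A) (here refl) s∈ = ∈-++⁺ˡ (∈-map⁺ (x ∷_) (∈-subseqs-++ʳ A s∈))
∷-∈-subseqs-++ (x ∷ A) (there a∈)  s∈ = ∈-++⁺ʳ (map (x ∷_) (subseqs (A ++ _))) (∷-∈-subseqs-++ A a∈ s∈)

a<b<m⇒¬132-free : ∀ A B {a b m} → a ∈ A → b ∈ B → a < b → b < m → copies (A ++ m ∷ B) p132 ≢ 0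
a<b<m⇒¬132-free A B {a} {b} {m} a∈ b∈ a<b b<m = copies-≢0 (A ++ m ∷ B) p132 amb∈ amb≅132
  where
  amb∈ : a ∷ m ∷ b ∷ [] ∈ subseqs (A ++ m ∷ B)
  amb∈ = ∷-∈-subseqs-++ A a∈ (∈-++⁺ˡ (∈-map⁺ (m ∷_) (subst (λ B → b ∷ [] ∈ subseqs B) (++-identityʳ B)
                                                         (∷-∈-subseqs-++ B b∈ ([]∈subseqs [])))))
  amb≅132 : orderIso (a ∷ m ∷ b ∷ []) p132 ≡ true
  amb≅132 rewrite <⇒<ᵇ≡true (<-trans a<b b<m) | ≤⇒<ᵇ≡false (<⇒≤ (<-trans a<b b<m))
                | <⇒<ᵇ≡true a<b | ≤⇒<ᵇ≡false (<⇒≤ a<b) | ≤⇒<ᵇ≡false (<⇒≤ b<m) | <⇒<ᵇ≡true b<m = refl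

range-filter-≤ : ∀ {t n} → t ≤ n → filter (_≤? t) (range n) ≡ range t
range-filter-≤ {t} {n} t≤n = begin
  filter (_≤? t) (range n)                                        ≡⟨ cong (filter (_≤? t) ∘ range) (m+[n∸m]≡n t≤n) ⟨
  filter (_≤? t) (range (t + (n ∸ t)))                            ≡⟨ cong (filter (_≤? t)) (range-+ t (n ∸ t)) ⟩
  filter (_≤? t) (range t ++ map (t +_) (range (n ∸ t)))          ≡⟨ filter-++ (_≤? t) (range t) _ ⟩
  filter (_≤? t) (range t) ++ filter (_≤? t) (map (t +_) (range (n ∸ t)))
    ≡⟨ cong₂ _++_ (filter-all (_≤? t) (All.tabulate (proj₂ ∘ ∈-range⁻ t)))
                  (filter-none (_≤? t) (All.tabulate (<⇒≱ ∘ above-t))) ⟩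
  range t ++ []                                                   ≡⟨ ++-identityʳ (range t) ⟩
  range t                                                         ∎
  where
  open ≡-Reasoning
  above-t : ∀ {x} → x ∈ map (t +_) (range (n ∸ t)) → t < x
  above-t x∈ with ∈-map⁻ (t +_) x∈
  ... | y , y∈ , refl = subst (_≤ t + y) (+-comm t 1) (+-monoʳ-≤ t (proj₁ (∈-range⁻ (n ∸ t) y∈)))

range-filter-> : ∀ {t n} → t ≤ n → filter (t <?_) (range n) ≡ map (t +_) (range (n ∸ t))
range-filter-> {t} {n} t≤n = begin
  filter (t <?_) (range n)                                        ≡⟨ cong (filter (t <?_) ∘ range) (m+[n∸m]≡n t≤n) ⟨
  filter (t <?_) (range (t + (n ∸ t)))                            ≡⟨ cong (filter (t <?_)) (range-+ t (n ∸ t)) ⟩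
  filter (t <?_) (range t ++ map (t +_) (range (n ∸ t)))          ≡⟨ filter-++ (t <?_) (range t) _ ⟩
  filter (t <?_) (range t) ++ filter (t <?_) (map (t +_) (range (n ∸ t)))
    ≡⟨ cong₂ _++_ (filter-none (t <?_) (All.tabulate (≤⇒≯ ∘ proj₂ ∘ ∈-range⁻ t)))
                  (filter-all (t <?_) (All.tabulate above-t)) ⟩
  map (t +_) (range (n ∸ t))                                      ∎
  where
  open ≡-Reasoning
  above-t : ∀ {x} → x ∈ map (t +_) (range (n ∸ t)) → t < x
  above-t x∈ with ∈-map⁻ (t +_) x∈
  ... | y , y∈ , refl = subst (_≤ t + y) (+-comm t 1) (+-monoʳ-≤ t (proj₁ (∈-range⁻ (n ∸ t) y∈)))

Unique-++-disjoint : ∀ (A C : List ℕ) {x} → Unique (A ++ C) → x ∈ A → x ∉ C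
Unique-++-disjoint (y ∷ A) C (y∉ ∷ _) (here refl) x∈C = All.lookup y∉ (∈-++⁺ʳ A x∈C) refl
Unique-++-disjoint (y ∷ A) C (_ ∷ u)  (there x∈)  x∈C = Unique-++-disjoint A C u x∈ x∈C

threshold-↭ : ∀ {A B n t} → A ++ B ↭ range n → All (t <_) A → All (_≤ t) B → t ≤ n →
              A ↭ map (t +_) (range (n ∸ t)) × B ↭ range t
threshold-↭ {A} {B} {n} {t} A++B↭ t<A B≤t t≤n = A↭ , B↭
  where
  A↭ : A ↭ map (t +_) (range (n ∸ t))
  A↭ = ↭-trans (↭-reflexive (sym filter≡A))
               (↭-trans (filter-↭ (t <?_) A++B↭) (↭-reflexive (range-filter-> t≤n)))
    where
    filter≡A : filter (t <?_) (A ++ B) ≡ A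
    filter≡A = trans (filter-++ (t <?_) A B)
      (trans (cong₂ _++_ (filter-all (t <?_) t<A) (filter-none (t <?_) (All.map ≤⇒≯ B≤t))) (++-identityʳ A))
  B↭ : B ↭ range t
  B↭ = ↭-trans (↭-reflexive (sym filter≡B))
               (↭-trans (filter-↭ (_≤? t) A++B↭) (↭-reflexive (range-filter-≤ t≤n)))
    where
    filter≡B : filter (_≤? t) (A ++ B) ≡ B
    filter≡B = trans (filter-++ (_≤? t) A B)
      (cong₂ _++_ (filter-none (_≤? t) (All.map <⇒≱ t<A)) (filter-all (_≤? t) B≤t))

unshift-↭ : ∀ {A t k} → All (t <_) A → A ↭ map (t +_) (range k) →
            map (_∸ t) A ↭ range k × map (t +_) (map (_∸ t) A) ≡ A
unshift-↭ {A} {t} {k} t<A A↭ =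
  ↭-trans (map⁺ (_∸ t) A↭) (↭-reflexive unshift-shift) , shift-unshift
  where
  unshift-shift : map (_∸ t) (map (t +_) (range k)) ≡ range k
  unshift-shift = trans (sym (map-∘ (range k))) (trans (map-cong (m+n∸m≡n t) (range k)) (map-id (range k)))
  shift-unshift : map (t +_) (map (_∸ t) A) ≡ A
  shift-unshift = trans (sym (map-∘ A)) (trans (map-cong-local (All.map (m+[n∸m]≡n ∘ <⇒≤) t<A)) (map-id A))

-- In a 132-avoider, everything left of the maximum exceeds everything right of it.
Avoiders⊆gluings : ∀ n {p} → p ∈ Avoiders (suc n) → p ∈ gluings n
Avoiders⊆gluings n p∈ with ∈-Avoiders⁻ (suc n) p∈
... | p↭ , avoids with removeMax n p↭
...   | A , B , refl , A++B↭ = subst (_∈ gluings n) (sym p≡glue) (∈-gluings⁺ n k+t≡n L∈ B∈)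
  where
  within : ∀ {x} → x ∈ A ++ B → 1 ≤ x × x ≤ n
  within x∈ = ∈-range⁻ n (∈-resp-↭ A++B↭ x∈)
  B<A : ∀ {a b} → a ∈ A → b ∈ B → b < a
  B<A {a} {b} a∈ b∈ with <-cmp a b
  ... | tri< a<b _ _  = ⊥-elim (a<b<m⇒¬132-free A B a∈ b∈ a<b (s≤s (proj₂ (within (∈-++⁺ʳ A b∈)))) avoids)
  ... | tri≈ _ refl _ = ⊥-elim (Unique-++-disjoint A _ (Unique-resp-↭ (↭-sym p↭) (range-unique (suc n))) a∈ (there b∈))
  ... | tri> _ _ b<a  = b<a
  t = max 0 B
  k = n ∸ t
  t<A : All (t <_) A
  t<A = All.tabulate λ a∈ → max<v⁺ (proj₁ (within (∈-++⁺ˡ a∈))) (All.tabulate (B<A a∈))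
  t≤n : t ≤ n
  t≤n = max≤v⁺ z≤n (All.tabulate (proj₂ ∘ within ∘ ∈-++⁺ʳ A))
  k+t≡n : k + t ≡ n
  k+t≡n = m∸n+n≡m t≤n
  A↭ : A ↭ map (t +_) (range k)
  A↭ = proj₁ (threshold-↭ A++B↭ t<A (xs≤max 0 B) t≤n)
  B↭ : B ↭ range t
  B↭ = proj₂ (threshold-↭ A++B↭ t<A (xs≤max 0 B) t≤n)
  L = map (_∸ t) A
  L↭ : L ↭ range k
  L↭ = proj₁ (unshift-↭ {k = k} t<A A↭)
  p≡glue : A ++ suc n ∷ B ≡ glue k t L B
  p≡glue = cong₂ (λ A x → A ++ suc x ∷ B) (sym (proj₂ (unshift-↭ {k = k} t<A A↭))) (sym k+t≡n)
  L+B-avoid : copies L p132 + copies B p132 ≡ 0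
  L+B-avoid = begin
    copies L p132 + copies B p132         ≡⟨ GlueCounts.copies-glue-132 (↭-range⇒Within k L↭) (↭-range⇒Within t B↭) ⟨
    copies (glue k t L B) p132            ≡⟨ cong (λ p → copies p p132) p≡glue ⟨
    copies (A ++ suc n ∷ B) p132          ≡⟨ avoids ⟩
    0                                     ∎
    where open ≡-Reasoning
  L∈ : L ∈ Avoiders k
  L∈ = ∈-Avoiders⁺ k L↭ (m+n≡0⇒m≡0 (copies L p132) L+B-avoid)
  B∈ : B ∈ Avoiders t
  B∈ = ∈-Avoiders⁺ t B↭ (m+n≡0⇒n≡0 (copies L p132) L+B-avoid)

Avoiders-suc↭gluings : ∀ n → Avoiders (suc n) ↭ gluings n
Avoiders-suc↭gluings n = ∼bag⇒↭ (unique∧set⇒bag (Avoiders-unique (suc n)) (gluings-unique n)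
  (mk⇔ (Avoiders⊆gluings n) (gluings⊆Avoiders n)))

∑-Avoiders-suc : ∀ n f → ∑ (Avoiders (suc n)) f ≡
  antidiagonal (λ i j → ∑[ L ∈ Avoiders i ] ∑[ R ∈ Avoiders j ] f (glue i j L R)) n
∑-Avoiders-suc n f = begin
  ∑ (Avoiders (suc n)) f
    ≡⟨ ∑-↭ f (Avoiders-suc↭gluings n) ⟩
  ∑ (gluings n) f
    ≡⟨ ∑-concatMap gluingsAt (antidiagonalPairs n) f ⟩
  ∑[ ij ∈ antidiagonalPairs n ] ∑ (gluingsAt ij) f
    ≡⟨ ∑-cong (antidiagonalPairs n) (λ {ij} _ → ∑-gluingsAt ij) ⟩
  ∑[ ij ∈ antidiagonalPairs n ] G (proj₁ ij) (proj₂ ij)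
    ≡⟨ ∑-antidiagonalPairs G n ⟩
  antidiagonal G n ∎
  where
  open ≡-Reasoning
  G : ℕ → ℕ → ℕ
  G i j = ∑[ L ∈ Avoiders i ] ∑[ R ∈ Avoiders j ] f (glue i j L R)
  ∑-gluingsAt : ∀ ij → ∑ (gluingsAt ij) f ≡ G (proj₁ ij) (proj₂ ij)
  ∑-gluingsAt (i , j) = trans (∑-concatMap _ (Avoiders i) f)
    (∑-cong (Avoiders i) λ {L} _ → ∑-map (glue i j L) (Avoiders j) f)

-- The recurrences

total : (List ℕ → ℕ) → ℕ → ℕ
total f n = ∑ (Avoiders n) f

C : ℕ → ℕ
C = total (λ _ → 1)

∑∑-split : ∀ {A B : Set} (xs : List A) (ys : List B) f g x y →
  ∑[ a ∈ xs ] ∑[ b ∈ ys ] (f a + g b + x a * y b) ≡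
  ∑ xs f * (∑[ _ ∈ ys ] 1) + (∑[ _ ∈ xs ] 1) * ∑ ys g + ∑ xs x * ∑ ys y
∑∑-split xs ys f g x y = begin
  ∑[ a ∈ xs ] ∑[ b ∈ ys ] (f a + g b + x a * y b)
    ≡⟨ ∑-cong xs (λ {a} _ → trans (∑-+ ys _ _) (cong (_+ _) (∑-+ ys (λ _ → f a) g))) ⟩
  ∑[ a ∈ xs ] ((∑[ _ ∈ ys ] f a) + ∑ ys g + (∑[ b ∈ ys ] x a * y b))
    ≡⟨ trans (∑-+ xs _ _) (cong (_+ _) (∑-+ xs _ _)) ⟩
  (∑[ a ∈ xs ] ∑[ _ ∈ ys ] f a) + (∑[ _ ∈ xs ] ∑ ys g) + (∑[ a ∈ xs ] ∑[ b ∈ ys ] x a * y b)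
    ≡⟨ cong₂ (λ u v → u + v + _) (trans (∑-cong xs λ {a} _ → ∑-cong ys λ _ → sym (*-identityʳ (f a))) (∑∑-* xs ys f (λ _ → 1)))
                                  (trans (∑-cong xs λ _ → ∑-cong ys λ {b} _ → sym (*-identityˡ (g b))) (∑∑-* xs ys (λ _ → 1) g)) ⟩
  ∑ xs f * (∑[ _ ∈ ys ] 1) + (∑[ _ ∈ xs ] 1) * ∑ ys g + (∑[ a ∈ xs ] ∑[ b ∈ ys ] x a * y b)
    ≡⟨ cong (_ +_) (∑∑-* xs ys x y) ⟩
  ∑ xs f * (∑[ _ ∈ ys ] 1) + (∑[ _ ∈ xs ] 1) * ∑ ys g + ∑ xs x * ∑ ys y ∎
  where open ≡-Reasoning

recurrence-from-glue : ∀ (f x y : List ℕ → ℕ) →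
  (∀ {i j L R} → L ∈ Avoiders i → R ∈ Avoiders j → f (glue i j L R) ≡ f L + f R + x L * y R) →
  Recurrence C (total x ⋆ total y) (total f)
recurrence-from-glue f x y f-glue = recurrence λ n → begin
  total f (suc n)
    ≡⟨ ∑-Avoiders-suc n f ⟩
  antidiagonal (λ i j → ∑[ L ∈ Avoiders i ] ∑[ R ∈ Avoiders j ] f (glue i j L R)) n
    ≡⟨ antidiagonal-cong n (λ i j _ → trans (∑-cong (Avoiders i) λ L∈ → ∑-cong (Avoiders j) λ R∈ → f-glue L∈ R∈)
                                            (∑∑-split (Avoiders i) (Avoiders j) f f x y)) ⟩
  antidiagonal (λ i j → total f i * C j + C i * total f j + total x i * total y j) n
    ≡⟨ trans (antidiagonal-+ _ _ n) (cong (_+ _) (antidiagonal-+ _ _ n)) ⟩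
  (total f ⋆ C ⊕ C ⋆ total f ⊕ total x ⋆ total y) n ∎
  where open ≡-Reasoning

C-rec : ∀ n → C (suc n) ≡ (C ⋆ C) n
C-rec n = trans (∑-Avoiders-suc n (λ _ → 1))
                (antidiagonal-cong n λ i j _ → ∑∑-* (Avoiders i) (Avoiders j) (λ _ → 1) (λ _ → 1))

total-length : total length ≗ weighted C
total-length n = trans (∑-cong (Avoiders n) (∈-Avoiders⇒length n))
                       (trans (∑-cong (Avoiders n) λ _ → sym (*-identityʳ n)) (∑-*ˡ (Avoiders n) n (λ _ → 1)))

total-+ : ∀ f g → total (λ p → f p + g p) ≗ total f ⊕ total g
total-+ f g n = ∑-+ (Avoiders n) f g

total-suc-length : total (suc ∘ length) ≗ C ⊕ weighted C
total-suc-length n = trans (total-+ (λ _ → 1) length n) (cong (C n +_) (total-length n))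

-- count q n is S n p132 q by definition.
count : List ℕ → ℕ → ℕ
count q = total (λ p → copies p q)

module Counts {i j L R} (L∈ : L ∈ Avoiders i) (R∈ : R ∈ Avoiders j) =
  GlueCounts (∈-Avoiders⇒Within i L∈) (∈-Avoiders⇒Within j R∈)

A-rec : Recurrence C (weighted C ⋆ C) (count p12)
A-rec = recurrence-resp (⋆-cong total-length (λ _ → refl))
  (recurrence-from-glue _ length (λ _ → 1) Counts.copies-glue-12)

I-rec : Recurrence C ((C ⊕ weighted C) ⋆ weighted C) (count p21)
I-rec = recurrence-resp (⋆-cong total-suc-length total-length)
  (recurrence-from-glue _ (suc ∘ length) length Counts.copies-glue-21)

open CatalanConvolutions C (count p12) (count p21) C-rec refl A-rec refl I-rec

T213-rec : Recurrence C U (count p213)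
T213-rec = recurrence-resp I⋆C≗U
  (recurrence-from-glue _ (λ L → copies L p21) (λ _ → 1) Counts.copies-glue-213)

T312-rec : Recurrence C U (count p312)
T312-rec = recurrence-resp (λ n → trans (⋆-cong total-suc-length (λ _ → refl) n) ([C⊕E]⋆A≗U n))
  (recurrence-from-glue _ (suc ∘ length) (λ R → copies R p12) Counts.copies-glue-312)

T231-rec : Recurrence C U (count p231)
T231-rec = recurrence-resp (λ n → trans (⋆-cong A+length≗A⊕E total-length n) ([A⊕E]⋆E≗U n))
  (recurrence-from-glue _ (λ L → copies L p12 + length L) length Counts.copies-glue-231)
  where
  A+length≗A⊕E : total (λ p → copies p p12 + length p) ≗ count p12 ⊕ E
  A+length≗A⊕E n = trans (total-+ (λ p → copies p p12) length n) (cong (count p12 n +_) (total-length n))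

mainTheorem1 : (n : ℕ) → 1 Data.Nat.≤ n →
    (S n p132 p231 ≡ S n p132 p312) × (S n p132 p312 ≡ S n p132 p213)
mainTheorem1 n _ = recurrence-unique T231-rec T312-rec refl n , recurrence-unique T312-rec T213-rec refl n
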